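{- Let $H\in\Gamma$ and let $m>2$. If $H$ has at most $m$ branch vertices (vertices of degree $3$), then the clique-width of $H$ is at most $3\cdot 2^{m-1}$.
   Context: For $n\ge 3$ let $G_{n,n}$ be the $n\times n$ grid (vertices $(i,j)$, $1\le i,j\le n$, with $(i,j)$ adjacent to $(i,j+1)$ and $(i+1,j)$ when these exist). $T_n$ is obtained from $G_{n,n}$ by (1) removing every vertex $v$ of degree $2$ and inserting an edge between the two neighbours of $v$, and (2) replacing every vertex $v$ of degree $4$ by four new vertices $v_1,v_2,v_3,v_4$ connected in a $4$-cycle so that the four edges formerly incident on $v$ are now each incident on a distinct one of the new vertices. For a positive integer $t$, $G^t$ denotes the graph obtained from $G$ by replacing each edge by a path of length $t$. $\Gamma$ is the class of all graphs $H$ that are induced subgraphs of $T_n^n$ for some $n>2$. In a graph of $\Gamma$, a branch vertex is a vertex of degree $3$. -}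

module Defs where

open import Data.Nat using (ℕ; zero; suc; _+_; _∸_; _<_; _≡ᵇ_)
open import Data.Fin using (Fin; toℕ; splitAt; _≟_)
open import Data.Bool using (Bool; true; false; _∨_; _∧_; if_then_else_)
open import Data.List using (List; map; allFin)
open import Data.Sum using (_⊎_; inj₁; inj₂)
open import Data.Product using (Σ; _×_; _,_; proj₁; proj₂)
open import Relation.Binary.PropositionalEquality using (_≡_)
open import Relation.Nullary using (¬_; does)
open import Function.Bundles using (_↔_; Inverse)

record FinGraph : Set where
  field
    size : ℕ
    adj  : Fin size → Fin size → Bool
open FinGraph public

countTrue : List Bool → ℕ
countTrue List.[] = 0
countTrue (true List.∷ bs) = suc (countTrue bs)
countTrue (false List.∷ bs) = countTrue bs

deg : (H : FinGraph) → Fin (size H) → ℕ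
deg H u = countTrue (map (adj H u) (allFin (size H)))

branchCount : FinGraph → ℕ
branchCount H = countTrue (map (λ u → deg H u ≡ᵇ 3) (allFin (size H)))

data Expr (c : ℕ) : ℕ → Set where
  vtx     : Fin c → Expr c 1
  _⊕_     : ∀ {a b} → Expr c a → Expr c b → Expr c (a + b)
  join    : ∀ {k} (i j : Fin c) → ¬ (i ≡ j) → Expr c k → Expr c k
  relabel : ∀ {k} (i j : Fin c) → Expr c k → Expr c k

labels : ∀ {c k} → Expr c k → Fin k → Fin c
adjE   : ∀ {c k} → Expr c k → Fin k → Fin k → Bool

labels (vtx i) _ = i
labels (_⊕_ {a} e f) u with splitAt a u
... | inj₁ x = labels e x
... | inj₂ y = labels f y
labels (join i j _ e) u = labels e u
labels (relabel i j e) u = if does (labels e u ≟ i) then j else labels e u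

adjE (vtx i) _ _ = false
adjE (_⊕_ {a} e f) u v with splitAt a u | splitAt a v
... | inj₁ x | inj₁ y = adjE e x y
... | inj₂ x | inj₂ y = adjE f x y
... | inj₁ _ | inj₂ _ = false
... | inj₂ _ | inj₁ _ = false
adjE (join i j _ e) u v =
  adjE e u v
  ∨ (does (labels e u ≟ i) ∧ does (labels e v ≟ j))
  ∨ (does (labels e u ≟ j) ∧ does (labels e v ≟ i))
adjE (relabel i j e) u v = adjE e u v

-- clique-width of H is at most c (the empty graph has clique-width 0)
CliqueWidth≤ : ℕ → FinGraph → Set
CliqueWidth≤ c H =
  size H ≡ 0
  ⊎ Σ (Expr c (size H)) λ e →
      Σ (Fin (size H) ↔ Fin (size H)) λ σ →
        ∀ u v → adj H u v ≡ adjE e (Inverse.to σ u) (Inverse.to σ v)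

-- The graphs T_n.  Grid vertex (i , j), 0 ≤ i , j < n (0-indexed),
-- i = row (north = smaller i), j = column (east = larger j).

data Dir : Set where
  N E S W : Dir

next : Dir → Dir
next N = E
next E = S
next S = W
next W = N

Side : ℕ → ℕ → Set
Side n i = (i ≡ 0) ⊎ (suc i ≡ n)

Inner : ℕ → ℕ → Set
Inner n i = (0 < i) × (suc i < n)

Deg3 : ℕ → ℕ → ℕ → Set
Deg3 n i j = (Inner n i × Side n j) ⊎ (Side n i × Inner n j)

-- vertices of T_n: degree-3 grid vertices kept, degree-4 ones replaced by
-- four vertices (one per direction), corners (degree 2) removed
data TV (n : ℕ) : Set where
  b3 : (i j : ℕ) → Deg3 n i j → TV n
  c4 : (i j : ℕ) → Inner n i → Inner n j → Dir → TV n

-- Port n i j d v : v is the vertex of T_n at grid point (i , j) on which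
-- the former grid edge leaving (i , j) in direction d is incident
data Port (n : ℕ) : ℕ → ℕ → Dir → TV n → Set where
  p3 : ∀ {i j d} (p : Deg3 n i j) → Port n i j d (b3 i j p)
  p4 : ∀ {i j d} (a : Inner n i) (b : Inner n j) → Port n i j d (c4 i j a b d)

-- edges of T_n, each listed once with an orientation
data TE (n : ℕ) : TV n → TV n → Set where
  hor : ∀ {i j u v} → Port n i j E u → Port n i (suc j) W v → TE n u v
  ver : ∀ {i j u v} → Port n i j S u → Port n (suc i) j N v → TE n u v
  -- edges replacing the four corners (degree-2 vertices)
  cornerNW : ∀ {u v} → Port n 0 1 W u → Port n 1 0 N v → TE n u v
  cornerNE : ∀ {u v} k → suc (suc k) ≡ n →
             Port n 0 k E u → Port n 1 (suc k) N v → TE n u v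
  cornerSW : ∀ {u v} k → suc (suc k) ≡ n →
             Port n k 0 S u → Port n (suc k) 1 W v → TE n u v
  cornerSE : ∀ {u v} k → suc (suc k) ≡ n →
             Port n (suc k) k E u → Port n k (suc k) S v → TE n u v
  -- 4-cycles replacing degree-4 vertices
  cyc : ∀ {i j} (a : Inner n i) (b : Inner n j) (d : Dir) →
        TE n (c4 i j a b d) (c4 i j a b (next d))

record Pres : Set₁ where
  field
    V   : Set
    Ed  : Set
    src : Ed → V
    tgt : Ed → V

TPres : ℕ → Pres
TPres n = record
  { V = TV n
  ; Ed = Σ (TV n × TV n) (λ p → TE n (proj₁ p) (proj₂ p))
  ; src = λ e → proj₁ (proj₁ e)
  ; tgt = λ e → proj₂ (proj₁ e) }

-- vertices of P^t: original vertices, and internal vertices mid e k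
-- (k = 0 .. t-2, the (k+1)-st vertex on the path replacing e)
data SV (P : Pres) (t : ℕ) : Set where
  orig : Pres.V P → SV P t
  mid  : Pres.Ed P → Fin (t ∸ 1) → SV P t

data SE (P : Pres) (t : ℕ) : SV P t → SV P t → Set where
  direct : ∀ e → t ≡ 1 → SE P t (orig (Pres.src P e)) (orig (Pres.tgt P e))
  first  : ∀ e (k : Fin (t ∸ 1)) → toℕ k ≡ 0 →
           SE P t (orig (Pres.src P e)) (mid e k)
  inner  : ∀ e (k k′ : Fin (t ∸ 1)) → toℕ k′ ≡ suc (toℕ k) →
           SE P t (mid e k) (mid e k′)
  last   : ∀ e (k : Fin (t ∸ 1)) → suc (toℕ k) ≡ t ∸ 1 →
           SE P t (mid e k) (orig (Pres.tgt P e))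

SAdj : (P : Pres) (t : ℕ) → SV P t → SV P t → Set
SAdj P t x y = SE P t x y ⊎ SE P t y x

TnnV : ℕ → Set
TnnV n = SV (TPres n) n

TnnAdj : (n : ℕ) → TnnV n → TnnV n → Set
TnnAdj n = SAdj (TPres n) n

InΓ : FinGraph → Set
InΓ H =
  Σ ℕ λ n → (2 < n) ×
  Σ (Fin (size H) → TnnV n) λ f →
    (∀ u v → f u ≡ f v → u ≡ v) ×
    (∀ u v → (adj H u v ≡ true → TnnAdj n (f u) (f v))
           × (TnnAdj n (f u) (f v) → adj H u v ≡ true))

-- Every graph of Γ is simple with maximum degree 3: in T_n an edge is determined by either
-- endpoint and the label of its end there, so a vertex of T_n^n has at most three neighbours.
-- A graph of maximum degree 3 with m branch vertices is built by adding its vertices one at a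
-- time; a placed vertex with unplaced neighbours is active and keeps a label of its own, all
-- other placed vertices share a dead label, and the new vertex gets a fresh label while it is
-- joined to its neighbours.  The non-branch vertices form paths and cycles, and always
-- continuing such a path from a placed non-branch vertex keeps at most two pending edges at
-- placed non-branch vertices.  Hence at most m + 2 vertices are active at any time, and
-- m + 3 slot labels, a fresh and a dead label give clique-width at most m + 5 ≤ 3·2^(m-1).

module Submission where

open import Defs

open import Data.Nat hiding (_≟_)
open import Data.Nat.Properties hiding (_≟_)
open import Data.Fin as F using (Fin; zero; suc; _≟_; toℕ)
import Data.Fin.Properties as FinP
open import Data.Bool using (Bool; true; false; _∧_; _∨_; not; if_then_else_)
open import Data.Bool.Properties using (∧-zeroʳ; ∨-zeroʳ; ∨-identityʳ; ∧-assoc)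
open import Data.List using (List; []; _∷_; length; lookup; tabulate; map; allFin)
open import Data.List.Properties using (map-tabulate; length-map)
open import Data.List.Relation.Unary.Any using (here; there)
open import Data.List.Membership.Propositional using (_∈_)
open import Data.List.Membership.Propositional.Properties using (∈-map⁺)
open import Data.Product using (Σ; ∃; _×_; _,_; proj₁; proj₂)
open import Data.Sum using (_⊎_; inj₁; inj₂; swap)
open import Data.Maybe using (Maybe; just; nothing)
open import Data.Maybe.Properties using (just-injective)
open import Data.Empty using (⊥; ⊥-elim)
open import Data.Unit using (⊤; tt)
open import Function using (_∘_)
open import Function.Bundles using (_↔_; Injection; mk↔ₛ′)
open import Function.Properties.Inverse using (↔-sym; ↔⇒↣)
open import Relation.Nullary using (¬_; Dec; yes; no; does)
open import Relation.Nullary.Decidable using (dec-true; dec-false)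
open import Relation.Binary.PropositionalEquality
open import Algebra.Properties.CommutativeMonoid.Sum +-0-commutativeMonoid
  using (sum; sum-cong-≗; ∑-distrib-+)

-- Counting over finite sets

indicator : Bool → ℕ
indicator true = 1
indicator false = 0

count : ∀ {k} → (Fin k → Bool) → ℕ
count P = sum (indicator ∘ P)

countTrue-tabulate : ∀ {k} (P : Fin k → Bool) → countTrue (tabulate P) ≡ count P
countTrue-tabulate {zero} P = refl
countTrue-tabulate {suc k} P with P zero
... | true = cong suc (countTrue-tabulate (P ∘ suc))
... | false = countTrue-tabulate (P ∘ suc)

countTrue-allFin : ∀ {k} (P : Fin k → Bool) → countTrue (map P (allFin k)) ≡ count P
countTrue-allFin {k} P = trans (cong countTrue (map-tabulate (λ x → x) P)) (countTrue-tabulate P)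

count-true : ∀ k → count {k} (λ _ → true) ≡ k
count-true zero = refl
count-true (suc k) = cong suc (count-true k)

sum-mono-≤ : ∀ {k} {f g : Fin k → ℕ} → (∀ x → f x ≤ g x) → sum f ≤ sum g
sum-mono-≤ {zero} f≤g = z≤n
sum-mono-≤ {suc k} f≤g = +-mono-≤ (f≤g zero) (sum-mono-≤ (f≤g ∘ suc))

sum-zero : ∀ {k} {f : Fin k → ℕ} → (∀ x → f x ≡ 0) → sum f ≡ 0
sum-zero {zero} f≡0 = refl
sum-zero {suc k} f≡0 rewrite f≡0 zero = sum-zero (f≡0 ∘ suc)

term≤sum : ∀ {k} (f : Fin k → ℕ) z → f z ≤ sum f
term≤sum f zero = m≤m+n _ _
term≤sum f (suc z) = ≤-trans (term≤sum (f ∘ suc) z) (m≤n+m _ (f zero))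

sum-delta : ∀ {k} (z : Fin k) a → sum (λ w → if does (w ≟ z) then a else 0) ≡ a
sum-delta {suc k} zero a = trans (cong (a +_) (sum-zero {k} lemma)) (+-identityʳ a)
  where
  lemma : ∀ w → (if does (suc w ≟ zero) then a else 0) ≡ 0
  lemma w = refl
sum-delta {suc k} (suc z) a = trans (cong (0 +_) (sum-cong-≗ lemma)) (sum-delta z a)
  where
  lemma : ∀ w → (if does (suc w ≟ suc z) then a else 0) ≡ (if does (w ≟ z) then a else 0)
  lemma w with w ≟ z
  ... | yes _ = refl
  ... | no _ = refl

module _ {C : Set} where
  open import Data.List.Relation.Unary.Any using (_─_)

  length-─ : ∀ {y : C} (cs : List C) (p : y ∈ cs) → length cs ≡ suc (length (cs ─ p))
  length-─ (_ ∷ cs) (here _) = refl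
  length-─ (_ ∷ cs) (there p) = cong suc (length-─ cs p)

  ∈-─ : ∀ {x y : C} (cs : List C) (p : y ∈ cs) → x ∈ cs → x ≢ y → x ∈ (cs ─ p)
  ∈-─ (_ ∷ cs) (here refl) (here refl) x≢y = ⊥-elim (x≢y refl)
  ∈-─ (_ ∷ cs) (here _) (there q) x≢y = q
  ∈-─ (_ ∷ cs) (there p) (here x≡c) x≢y = here x≡c
  ∈-─ (_ ∷ cs) (there p) (there q) x≢y = there (∈-─ cs p q x≢y)

  count≤length : ∀ {k} (P : Fin k → Bool) (code : ∀ u → P u ≡ true → C) (cs : List C) →
    (∀ u v Pu Pv → code u Pu ≡ code v Pv → u ≡ v) →
    (∀ u Pu → code u Pu ∈ cs) → count P ≤ length cs
  count≤length {zero} P code cs inj cov = z≤n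
  count≤length {suc k} P code cs inj cov with P zero in P0
  ... | false = count≤length (P ∘ suc) (code ∘ suc) cs
                  (λ u v Pu Pv eq → FinP.suc-injective (inj _ _ Pu Pv eq)) (λ u → cov (suc u))
  ... | true = subst (suc (count (P ∘ suc)) ≤_) (sym (length-─ cs code0∈cs))
                 (s≤s (count≤length (P ∘ suc) (code ∘ suc) (cs ─ code0∈cs)
                   (λ u v Pu Pv eq → FinP.suc-injective (inj _ _ Pu Pv eq))
                   (λ u Pu → ∈-─ cs code0∈cs (cov (suc u) Pu) (λ eq → suc≢zero (inj _ _ Pu P0 eq)))))
    where
    code0∈cs = cov zero P0
    suc≢zero : ∀ {u : Fin k} → suc u ≢ zero
    suc≢zero ()

trues : ∀ {k} → (Fin k → Bool) → List (Fin k)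
trues {zero} P = []
trues {suc k} P with P zero
... | true = zero ∷ map suc (trues (P ∘ suc))
... | false = map suc (trues (P ∘ suc))

length-trues : ∀ {k} (P : Fin k → Bool) → length (trues P) ≡ count P
length-trues {zero} P = refl
length-trues {suc k} P with P zero
... | true = cong suc (trans (length-map suc (trues (P ∘ suc))) (length-trues (P ∘ suc)))
... | false = trans (length-map suc (trues (P ∘ suc))) (length-trues (P ∘ suc))

∈-trues : ∀ {k} (P : Fin k → Bool) x → P x ≡ true → x ∈ trues P
∈-trues {suc k} P x Px with P zero in P0
∈-trues {suc k} P zero Px | true = here refl
∈-trues {suc k} P (suc x) Px | true = there (∈-map⁺ suc (∈-trues (P ∘ suc) x Px))
∈-trues {suc k} P zero Px | false with trans (sym P0) Px
... | ()
∈-trues {suc k} P (suc x) Px | false = ∈-map⁺ suc (∈-trues (P ∘ suc) x Px)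

count-mono-injection : ∀ {j k} (Q : Fin j → Bool) (P : Fin k → Bool) (g : Fin j → Fin k) →
  (∀ u v → Q u ≡ true → Q v ≡ true → g u ≡ g v → u ≡ v) →
  (∀ u → Q u ≡ true → P (g u) ≡ true) → count Q ≤ count P
count-mono-injection Q P g inj maps = subst (count Q ≤_) (length-trues P)
  (count≤length Q (λ u _ → g u) (trues P) inj (λ u Qu → ∈-trues P (g u) (maps u Qu)))

anyᵇ : ∀ {k} → (Fin k → Bool) → Bool
anyᵇ {zero} P = false
anyᵇ {suc k} P = P zero ∨ anyᵇ (P ∘ suc)

anyᵇ-intro : ∀ {k} (P : Fin k → Bool) x → P x ≡ true → anyᵇ P ≡ true
anyᵇ-intro P zero Px rewrite Px = refl
anyᵇ-intro P (suc x) Px with P zero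
... | true = refl
... | false = anyᵇ-intro (P ∘ suc) x Px

anyᵇ-witness : ∀ {k} (P : Fin k → Bool) → anyᵇ P ≡ true → ∃ λ x → P x ≡ true
anyᵇ-witness {suc k} P any with P zero in P0
... | true = zero , P0
... | false with anyᵇ-witness (P ∘ suc) any
... | x , Px = suc x , Px

anyᵇ-none : ∀ {k} (P : Fin k → Bool) → (∀ x → P x ≡ false) → anyᵇ P ≡ false
anyᵇ-none {zero} P none = refl
anyᵇ-none {suc k} P none rewrite none zero = anyᵇ-none (P ∘ suc) (none ∘ suc)

anyᵇ-false : ∀ {k} (P : Fin k → Bool) → anyᵇ P ≡ false → ∀ x → P x ≡ false
anyᵇ-false P any x with P x in Px
... | false = refl
... | true = trans (sym (anyᵇ-intro P x Px)) any

true≢false : true ≢ false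
true≢false ()

∧-true⁻ : ∀ {a b} → (a ∧ b) ≡ true → (a ≡ true) × (b ≡ true)
∧-true⁻ {true} {true} _ = refl , refl

not-true⁻ : ∀ {b} → not b ≡ true → b ≡ false
not-true⁻ {false} _ = refl

not-false⁻ : ∀ {b} → not b ≡ false → b ≡ true
not-false⁻ {true} _ = refl

positive : ℕ → Bool
positive zero = false
positive (suc _) = true

positive⁺ : ∀ {a} → 1 ≤ a → positive a ≡ true
positive⁺ {suc a} _ = refl

positive⁻ : ∀ {a} → positive a ≡ true → 1 ≤ a
positive⁻ {suc a} _ = s≤s z≤n

-- Clique-width expressions

module LabelMap {c c′ : ℕ} (f : Fin c → Fin c′) (f-injective : ∀ x y → f x ≡ f y → x ≡ y) where

  mapLabels : ∀ {n} → Expr c n → Expr c′ n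
  mapLabels (vtx i) = vtx (f i)
  mapLabels (e ⊕ e′) = mapLabels e ⊕ mapLabels e′
  mapLabels (join i j i≢j e) = join (f i) (f j) (λ eq → i≢j (f-injective i j eq)) (mapLabels e)
  mapLabels (relabel i j e) = relabel (f i) (f j) (mapLabels e)

  does-f≟f : ∀ x y → does (f x ≟ f y) ≡ does (x ≟ y)
  does-f≟f x y with x ≟ y
  ... | yes refl = dec-true (f x ≟ f x) refl
  ... | no x≢y = dec-false (f x ≟ f y) (λ eq → x≢y (f-injective x y eq))

  labels-mapLabels : ∀ {n} (e : Expr c n) u → labels (mapLabels e) u ≡ f (labels e u)
  labels-mapLabels (vtx i) u = refl
  labels-mapLabels (_⊕_ {a} e e′) u with F.splitAt a u
  ... | inj₁ x = labels-mapLabels e x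
  ... | inj₂ y = labels-mapLabels e′ y
  labels-mapLabels (join i j _ e) u = labels-mapLabels e u
  labels-mapLabels (relabel i j e) u rewrite labels-mapLabels e u | does-f≟f (labels e u) i
    with does (labels e u ≟ i)
  ... | true = refl
  ... | false = refl

  adjE-mapLabels : ∀ {n} (e : Expr c n) u v → adjE (mapLabels e) u v ≡ adjE e u v
  adjE-mapLabels (vtx i) u v = refl
  adjE-mapLabels (_⊕_ {a} e e′) u v with F.splitAt a u | F.splitAt a v
  ... | inj₁ x | inj₁ y = adjE-mapLabels e x y
  ... | inj₂ x | inj₂ y = adjE-mapLabels e′ x y
  ... | inj₁ x | inj₂ y = refl
  ... | inj₂ x | inj₁ y = refl
  adjE-mapLabels (join i j _ e) u v
    rewrite adjE-mapLabels e u v | labels-mapLabels e u | labels-mapLabels e v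
          | does-f≟f (labels e u) i | does-f≟f (labels e v) j
          | does-f≟f (labels e u) j | does-f≟f (labels e v) i = refl
  adjE-mapLabels (relabel i j e) u v = adjE-mapLabels e u v

cliqueWidth≤-mono : ∀ {c c′} H → c ≤ c′ → CliqueWidth≤ c H → CliqueWidth≤ c′ H
cliqueWidth≤-mono H c≤c′ (inj₁ empty) = inj₁ empty
cliqueWidth≤-mono H c≤c′ (inj₂ (e , σ , represents)) =
  inj₂ (mapLabels e , σ , λ u v → trans (represents u v) (sym (adjE-mapLabels e _ _)))
  where open LabelMap (λ x → F.inject≤ x c≤c′) (λ x y → FinP.inject≤-injective c≤c′ c≤c′ x y)

module SlotLabels (slots : ℕ) where

  Label : Set
  Label = Fin (suc (suc slots))

  fresh dead : Label
  fresh = zero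
  dead = suc zero

  Exp : ℕ → Set
  Exp = Expr (suc (suc slots))

  slot : Fin slots → Label
  slot s = suc (suc s)

  isFresh : Label → Bool
  isFresh x = does (x ≟ fresh)

  joinFresh : ∀ {L n} → (Fin L → Bool) → (Fin L → Fin slots) → Exp n → Exp n
  joinFresh {zero} c g e = e
  joinFresh {suc L} c g e with c zero
  ... | true = join fresh (slot (g zero)) (λ ()) (joinFresh (c ∘ suc) (g ∘ suc) e)
  ... | false = joinFresh (c ∘ suc) (g ∘ suc) e

  labels-joinFresh : ∀ {L n} c g (e : Exp n) u → labels (joinFresh {L} c g e) u ≡ labels e u
  labels-joinFresh {zero} c g e u = refl
  labels-joinFresh {suc L} c g e u with c zero
  ... | true = labels-joinFresh (c ∘ suc) (g ∘ suc) e u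
  ... | false = labels-joinFresh (c ∘ suc) (g ∘ suc) e u

  joinedToFresh : ∀ {L n} → (Fin L → Bool) → (Fin L → Fin slots) → Exp n → Fin n → Fin n → Bool
  joinedToFresh c g e u v = isFresh (labels e u) ∧ anyᵇ (λ q → c q ∧ does (labels e v ≟ slot (g q)))

  private
    join-step : ∀ a nu nv x y s t →
      ((a ∨ (nu ∧ x) ∨ (nv ∧ y)) ∨ (nu ∧ s) ∨ (t ∧ nv)) ≡ (a ∨ (nu ∧ (s ∨ x)) ∨ (nv ∧ (t ∨ y)))
    join-step = solve 7 (λ a nu nv x y s t →
      ((a :+ ((nu :* x) :+ (nv :* y))) :+ ((nu :* s) :+ (t :* nv)))
        := (a :+ ((nu :* (s :+ x)) :+ (nv :* (t :+ y))))) refl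
      where open import Data.Bool.Solver using (module ∨-∧-Solver)
            open ∨-∧-Solver

  adjE-joinFresh : ∀ {L n} c g (e : Exp n) u v →
    adjE (joinFresh {L} c g e) u v ≡ (adjE e u v ∨ joinedToFresh c g e u v ∨ joinedToFresh c g e v u)
  adjE-joinFresh {zero} c g e u v
    rewrite ∧-zeroʳ (isFresh (labels e u)) | ∧-zeroʳ (isFresh (labels e v)) = sym (∨-identityʳ _)
  adjE-joinFresh {suc L} c g e u v with c zero
  ... | false = adjE-joinFresh (c ∘ suc) (g ∘ suc) e u v
  ... | true
    rewrite labels-joinFresh (c ∘ suc) (g ∘ suc) e u
          | labels-joinFresh (c ∘ suc) (g ∘ suc) e v
          | adjE-joinFresh (c ∘ suc) (g ∘ suc) e u v
    = join-step (adjE e u v) (isFresh (labels e u)) (isFresh (labels e v))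
        (anyᵇ (λ q → c (suc q) ∧ does (labels e v ≟ slot (g (suc q)))))
        (anyᵇ (λ q → c (suc q) ∧ does (labels e u ≟ slot (g (suc q)))))
        (does (labels e v ≟ slot (g zero))) (does (labels e u ≟ slot (g zero)))

  killSlots : ∀ {L n} → (Fin L → Bool) → (Fin L → Fin slots) → Exp n → Exp n
  killSlots {zero} d g e = e
  killSlots {suc L} d g e with d zero
  ... | true = relabel (slot (g zero)) dead (killSlots (d ∘ suc) (g ∘ suc) e)
  ... | false = killSlots (d ∘ suc) (g ∘ suc) e

  adjE-killSlots : ∀ {L n} d g (e : Exp n) u v → adjE (killSlots {L} d g e) u v ≡ adjE e u v
  adjE-killSlots {zero} d g e u v = refl
  adjE-killSlots {suc L} d g e u v with d zero
  ... | true = adjE-killSlots (d ∘ suc) (g ∘ suc) e u v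
  ... | false = adjE-killSlots (d ∘ suc) (g ∘ suc) e u v

  labels-killSlots : ∀ {L n} d g (e : Exp n) u →
    labels (killSlots {L} d g e) u ≡
      (if anyᵇ (λ q → d q ∧ does (labels e u ≟ slot (g q))) then dead else labels e u)
  labels-killSlots {zero} d g e u = refl
  labels-killSlots {suc L} d g e u with d zero
  ... | false = labels-killSlots (d ∘ suc) (g ∘ suc) e u
  ... | true rewrite labels-killSlots (d ∘ suc) (g ∘ suc) e u
      with anyᵇ (λ q → d (suc q) ∧ does (labels e u ≟ slot (g (suc q))))
  ... | true with labels e u ≟ slot (g zero)
  ...   | yes _ = refl
  ...   | no _ = refl
  labels-killSlots {suc L} d g e u | true | false with labels e u ≟ slot (g zero)
  ...   | yes _ = refl
  ...   | no _ = refl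

  -- There is no expression for the empty graph; Exp₀ 0 stands in for it.
  Exp₀ : ℕ → Set
  Exp₀ zero = ⊤
  Exp₀ (suc n) = Exp (suc n)

  labels₀ : ∀ {n} → Exp₀ n → Fin n → Label
  labels₀ {suc n} e = labels e

  adjE₀ : ∀ {n} → Exp₀ n → Fin n → Fin n → Bool
  adjE₀ {suc n} e = adjE e

  addFresh : ∀ {n} → Exp₀ n → Exp (suc n)
  addFresh {zero} _ = vtx fresh
  addFresh {suc n} e = vtx fresh ⊕ e

  labels-addFresh-new : ∀ {n} (e : Exp₀ n) → labels (addFresh e) zero ≡ fresh
  labels-addFresh-new {zero} e = refl
  labels-addFresh-new {suc n} e = refl

  labels-addFresh-old : ∀ {n} (e : Exp₀ n) p → labels (addFresh e) (suc p) ≡ labels₀ e p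
  labels-addFresh-old {suc n} e p = refl

  adjE-addFresh-newˡ : ∀ {n} (e : Exp₀ n) v → adjE (addFresh e) zero v ≡ false
  adjE-addFresh-newˡ {zero} e zero = refl
  adjE-addFresh-newˡ {suc n} e zero = refl
  adjE-addFresh-newˡ {suc n} e (suc q) = refl

  adjE-addFresh-newʳ : ∀ {n} (e : Exp₀ n) u → adjE (addFresh e) u zero ≡ false
  adjE-addFresh-newʳ {zero} e zero = refl
  adjE-addFresh-newʳ {suc n} e zero = refl
  adjE-addFresh-newʳ {suc n} e (suc p) = refl

  adjE-addFresh-old : ∀ {n} (e : Exp₀ n) p q → adjE (addFresh e) (suc p) (suc q) ≡ adjE₀ e p q
  adjE-addFresh-old {suc n} e p q = refl

cliqueWidth≤-from-enumeration : ∀ {slots k L} (Adj : Fin k → Fin k → Bool) (e : SlotLabels.Exp₀ slots L)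
  (g : Fin L → Fin k) (h : Fin k → Fin L) → (∀ x → g (h x) ≡ x) → (∀ p → h (g p) ≡ p) →
  (∀ p q → SlotLabels.adjE₀ slots e p q ≡ Adj (g p) (g q)) →
  CliqueWidth≤ (2 + slots) (record { size = k ; adj = Adj })
cliqueWidth≤-from-enumeration {k = k} {L} Adj e g h gh hg represents
  with ≤-antisym (FinP.injective⇒≤ (Injection.injective (↔⇒↣ σ)))
                 (FinP.injective⇒≤ (Injection.injective (↔⇒↣ (↔-sym σ))))
  where
  σ : Fin L ↔ Fin k
  σ = mk↔ₛ′ g h gh hg
cliqueWidth≤-from-enumeration {k = zero} Adj e g h gh hg represents | refl = inj₁ refl
cliqueWidth≤-from-enumeration {k = suc k} Adj e g h gh hg represents | refl =
  inj₂ (e , mk↔ₛ′ h g hg gh , λ u v → sym (trans (represents (h u) (h v)) (cong₂ Adj (gh u) (gh v))))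

-- Linear clique-width of graphs of maximum degree three

module LinearConstruction {k} (Adj : Fin k → Fin k → Bool)
    (Adj-sym : ∀ x y → Adj x y ≡ Adj y x) (Adj-irrefl : ∀ x → Adj x x ≡ false) (slots : ℕ) where
  open SlotLabels slots

  placed : List (Fin k) → Fin k → Bool
  placed l x = anyᵇ (λ p → does (x ≟ lookup l p))

  pending : List (Fin k) → Fin k → ℕ
  pending l x = count (λ w → Adj x w ∧ not (placed l w))

  active : List (Fin k) → Fin k → Bool
  active l x = placed l x ∧ positive (pending l x)

  labelOf : List (Fin k) → (Fin k → Fin slots) → Fin k → Label
  labelOf l slotOf x = if active l x then slot (slotOf x) else dead

  labelOf≢fresh : ∀ l slotOf x → labelOf l slotOf x ≢ fresh
  labelOf≢fresh l slotOf x with active l x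
  ... | true = λ ()
  ... | false = λ ()

  placed-lookup : ∀ l p → placed l (lookup l p) ≡ true
  placed-lookup l p = anyᵇ-intro _ p (dec-true (lookup l p ≟ lookup l p) refl)

  placed-lookup⁻ : ∀ l x → placed l x ≡ true → ∃ λ p → lookup l p ≡ x
  placed-lookup⁻ l x px with anyᵇ-witness _ px
  ... | p , eq with x ≟ lookup l p
  ...   | yes x≡ = p , sym x≡

  pending-place : ∀ l z x → placed l z ≡ false →
    pending l x ≡ pending (z ∷ l) x + indicator (Adj x z)
  pending-place l z x z∉l =
    trans (sum-cong-≗ pointwise)
     (trans (∑-distrib-+ after atZ) (cong (pending (z ∷ l) x +_) (sum-delta z (indicator (Adj x z)))))
    where
    after atZ : Fin k → ℕ
    after w = indicator (Adj x w ∧ not (placed (z ∷ l) w))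
    atZ w = if does (w ≟ z) then indicator (Adj x z) else 0
    pointwise : ∀ w → indicator (Adj x w ∧ not (placed l w)) ≡ after w + atZ w
    pointwise w with w ≟ z
    ... | yes refl rewrite z∉l with Adj x w
    ...   | true = refl
    ...   | false = refl
    pointwise w | no _ = sym (+-identityʳ _)

  active-place⁻ : ∀ l z x → placed l z ≡ false → x ≢ z → active (z ∷ l) x ≡ true → active l x ≡ true
  active-place⁻ l z x z∉l x≢z act with x ≟ z
  ... | yes x≡z = ⊥-elim (x≢z x≡z)
  ... | no _ with placed l x
  ...   | true = positive⁺ (≤-trans (positive⁻ act)
                   (subst (pending (z ∷ l) x ≤_) (sym (pending-place l z x z∉l)) (m≤m+n _ _)))
  ...   | false = act

  active-by-unplaced-neighbour : ∀ l z y → placed l z ≡ false → placed l y ≡ true → Adj z y ≡ true →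
    active l y ≡ true
  active-by-unplaced-neighbour l z y z∉l y∈l zy rewrite y∈l =
    positive⁺ (≤-trans one≤ (term≤sum _ z))
    where
    one≤ : 1 ≤ indicator (Adj y z ∧ not (placed l z))
    one≤ rewrite Adj-sym y z | zy | z∉l = s≤s z≤n

  record Stage (l : List (Fin k)) : Set where
    field
      slotOf : Fin k → Fin slots
      expr : Exp₀ (length l)
      distinct : ∀ p q → lookup l p ≡ lookup l q → p ≡ q
      expr-adj : ∀ p q → adjE₀ expr p q ≡ Adj (lookup l p) (lookup l q)
      expr-labels : ∀ p → labels₀ expr p ≡ labelOf l slotOf (lookup l p)
      slots-distinct : ∀ x y → active l x ≡ true → active l y ≡ true → slotOf x ≡ slotOf y → x ≡ y

  initial : Fin slots → Stage []
  initial s = record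
    { slotOf = λ _ → s ; expr = tt ; distinct = λ () ; expr-adj = λ ()
    ; expr-labels = λ () ; slots-distinct = λ x y () }

  module Extend {l} (st : Stage l) (z : Fin k) (z∉l : placed l z ≡ false) (s : Fin slots)
      (s-free : ∀ y → active (z ∷ l) y ≡ true → y ≢ z → Stage.slotOf st y ≢ s) where
    open Stage st

    vertex : Fin (length l) → Fin k
    vertex = lookup l

    slotAt : Fin (length l) → Fin slots
    slotAt q = slotOf (vertex q)

    neighbourOfZ : Fin (length l) → Bool
    neighbourOfZ q = Adj z (vertex q)

    retired : Fin (length l) → Bool
    retired q = active l (vertex q) ∧ not (active (z ∷ l) (vertex q))

    slotOf′ : Fin k → Fin slots
    slotOf′ x = if does (x ≟ z) then s else slotOf x

    base : Exp (suc (length l))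
    base = addFresh expr

    joined : Exp (suc (length l))
    joined = joinFresh neighbourOfZ slotAt base

    killed : Exp (suc (length l))
    killed = killSlots retired slotAt joined

    expr′ : Exp (suc (length l))
    expr′ = relabel fresh (labelOf (z ∷ l) slotOf′ z) killed

    vertex≢z : ∀ p → vertex p ≢ z
    vertex≢z p eq = true≢false (trans (sym (placed-lookup l p)) (trans (cong (placed l) eq) z∉l))

    slotOf′-old : ∀ x → x ≢ z → slotOf′ x ≡ slotOf x
    slotOf′-old x x≢z rewrite dec-false (x ≟ z) x≢z = refl

    slotOf′-new : slotOf′ z ≡ s
    slotOf′-new rewrite dec-true (z ≟ z) refl = refl

    distinct′ : ∀ p q → lookup (z ∷ l) p ≡ lookup (z ∷ l) q → p ≡ q
    distinct′ zero zero eq = refl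
    distinct′ zero (suc q) eq = ⊥-elim (vertex≢z q (sym eq))
    distinct′ (suc p) zero eq = ⊥-elim (vertex≢z p eq)
    distinct′ (suc p) (suc q) eq = cong suc (distinct p q eq)

    slots-distinct′ : ∀ x y → active (z ∷ l) x ≡ true → active (z ∷ l) y ≡ true →
      slotOf′ x ≡ slotOf′ y → x ≡ y
    slots-distinct′ x y ax ay same = cases (x ≟ z) (y ≟ z)
      where
      cases : Dec (x ≡ z) → Dec (y ≡ z) → x ≡ y
      cases (yes x≡z) (yes y≡z) = trans x≡z (sym y≡z)
      cases (yes x≡z) (no y≢z) = ⊥-elim (s-free y ay y≢z
        (trans (sym (slotOf′-old y y≢z)) (trans (sym same) (trans (cong slotOf′ x≡z) slotOf′-new))))
      cases (no x≢z) (yes y≡z) = ⊥-elim (s-free x ax x≢z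
        (trans (sym (slotOf′-old x x≢z)) (trans same (trans (cong slotOf′ y≡z) slotOf′-new))))
      cases (no x≢z) (no y≢z) = slots-distinct x y
        (active-place⁻ l z x z∉l x≢z ax) (active-place⁻ l z y z∉l y≢z ay)
        (trans (sym (slotOf′-old x x≢z)) (trans same (slotOf′-old y y≢z)))

    survivor-not-killed : ∀ p → active (z ∷ l) (vertex p) ≡ true → active l (vertex p) ≡ true →
      ∀ q → (retired q ∧ does (slot (slotAt p) ≟ slot (slotAt q))) ≡ false
    survivor-not-killed p a′ a q with retired q in ret | slotAt p ≟ slotAt q
    ... | false | _ = refl
    ... | true | no _ = refl
    ... | true | yes same with ∧-true⁻ ret
    ...   | aq , not-a′q = ⊥-elim (true≢false (trans (sym not-a′q)
            (cong not (trans (cong (active (z ∷ l)) (sym (slots-distinct _ _ a aq same))) a′))))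

    retiree-killed : ∀ p → active l (vertex p) ≡ true → active (z ∷ l) (vertex p) ≡ false →
      (retired p ∧ does (slot (slotAt p) ≟ slot (slotAt p))) ≡ true
    retiree-killed p a a′ rewrite a | a′ = dec-true (slot (slotAt p) ≟ slot (slotAt p)) refl

    label-after-kill : ∀ p →
      (if anyᵇ (λ q → retired q ∧ does (labelOf l slotOf (vertex p) ≟ slot (slotAt q)))
       then dead else labelOf l slotOf (vertex p))
      ≡ labelOf (z ∷ l) slotOf′ (vertex p)
    label-after-kill p with active (z ∷ l) (vertex p) in a′ | active l (vertex p) in a
    ... | true | false = ⊥-elim (true≢false (trans (sym (active-place⁻ l z (vertex p) z∉l (vertex≢z p) a′)) a))
    ... | true | true
      rewrite anyᵇ-none _ (survivor-not-killed p a′ a) | slotOf′-old (vertex p) (vertex≢z p) = refl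
    ... | false | false with anyᵇ (λ q → retired q ∧ does (dead ≟ slot (slotAt q)))
    ...   | true = refl
    ...   | false = refl
    label-after-kill p | false | true
      rewrite anyᵇ-intro (λ q → retired q ∧ does (slot (slotAt p) ≟ slot (slotAt q))) p (retiree-killed p a a′)
      = refl

    killed-label-new : labels killed zero ≡ fresh
    killed-label-new =
      begin
        labels killed zero
      ≡⟨ labels-killSlots retired slotAt joined zero ⟩
        (if anyᵇ (λ q → retired q ∧ does (labels joined zero ≟ slot (slotAt q))) then dead else labels joined zero)
      ≡⟨ cong (λ x → if anyᵇ (λ q → retired q ∧ does (x ≟ slot (slotAt q))) then dead else x)
              (trans (labels-joinFresh neighbourOfZ slotAt base zero) (labels-addFresh-new expr)) ⟩
        (if anyᵇ (λ q → retired q ∧ false) then dead else fresh)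
      ≡⟨ cong (if_then dead else fresh) (anyᵇ-none _ (λ q → ∧-zeroʳ (retired q))) ⟩
        fresh
      ∎
      where open ≡-Reasoning

    killed-label-old : ∀ p → labels killed (suc p) ≡ labelOf (z ∷ l) slotOf′ (vertex p)
    killed-label-old p =
      begin
        labels killed (suc p)
      ≡⟨ labels-killSlots retired slotAt joined (suc p) ⟩
        (if anyᵇ (λ q → retired q ∧ does (labels joined (suc p) ≟ slot (slotAt q)))
         then dead else labels joined (suc p))
      ≡⟨ cong (λ x → if anyᵇ (λ q → retired q ∧ does (x ≟ slot (slotAt q))) then dead else x)
              (trans (labels-joinFresh neighbourOfZ slotAt base (suc p))
                     (trans (labels-addFresh-old expr p) (expr-labels p))) ⟩
        (if anyᵇ (λ q → retired q ∧ does (labelOf l slotOf (vertex p) ≟ slot (slotAt q)))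
         then dead else labelOf l slotOf (vertex p))
      ≡⟨ label-after-kill p ⟩
        labelOf (z ∷ l) slotOf′ (vertex p)
      ∎
      where open ≡-Reasoning

    expr′-labels : ∀ p → labels expr′ p ≡ labelOf (z ∷ l) slotOf′ (lookup (z ∷ l) p)
    expr′-labels zero rewrite killed-label-new = refl
    expr′-labels (suc p) rewrite killed-label-old p
      | dec-false (labelOf (z ∷ l) slotOf′ (vertex p) ≟ fresh) (labelOf≢fresh (z ∷ l) slotOf′ (vertex p)) = refl

    -- The slot of vertex p is joined to z exactly when p is a neighbour of z: every placed
    -- neighbour of z is active, and active vertices have distinct slots.
    joins-exactly-neighbours : ∀ p →
      anyᵇ (λ q → neighbourOfZ q ∧ does (labelOf l slotOf (vertex p) ≟ slot (slotAt q))) ≡ Adj z (vertex p)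
    joins-exactly-neighbours p with Adj z (vertex p) in zp
    ... | true rewrite active-by-unplaced-neighbour l z (vertex p) z∉l (placed-lookup l p) zp =
          anyᵇ-intro _ p (trans (cong (_∧ _) zp) (dec-true (slot (slotAt p) ≟ slot (slotAt p)) refl))
    ... | false with active l (vertex p) in ap
    ...   | false = anyᵇ-none _ (λ q → ∧-zeroʳ (neighbourOfZ q))
    ...   | true = anyᵇ-none _ not-joined
      where
      not-joined : ∀ q → (neighbourOfZ q ∧ does (slot (slotAt p) ≟ slot (slotAt q))) ≡ false
      not-joined q with neighbourOfZ q in zq | slotAt p ≟ slotAt q
      ... | false | _ = refl
      ... | true | no _ = refl
      ... | true | yes same = ⊥-elim (true≢false (trans (sym zq) (trans (cong (Adj z)
              (sym (slots-distinct _ _ ap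
                (active-by-unplaced-neighbour l z (vertex q) z∉l (placed-lookup l q) zq) same)))
              zp)))

    adjE-expr′ : ∀ u v → adjE expr′ u v ≡
      (adjE base u v ∨ joinedToFresh neighbourOfZ slotAt base u v ∨ joinedToFresh neighbourOfZ slotAt base v u)
    adjE-expr′ u v = trans (adjE-killSlots retired slotAt joined u v) (adjE-joinFresh neighbourOfZ slotAt base u v)

    old-not-fresh : ∀ p → isFresh (labels base (suc p)) ≡ false
    old-not-fresh p rewrite labels-addFresh-old expr p | expr-labels p =
      dec-false (labelOf l slotOf (vertex p) ≟ fresh) (labelOf≢fresh l slotOf (vertex p))

    joined-old : ∀ p → anyᵇ (λ q → neighbourOfZ q ∧ does (labels base (suc p) ≟ slot (slotAt q))) ≡ Adj z (vertex p)
    joined-old p rewrite labels-addFresh-old expr p | expr-labels p = joins-exactly-neighbours p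

    joined-new : anyᵇ (λ q → neighbourOfZ q ∧ does (labels base zero ≟ slot (slotAt q))) ≡ false
    joined-new rewrite labels-addFresh-new expr = anyᵇ-none _ (λ q → ∧-zeroʳ (neighbourOfZ q))

    expr′-adj : ∀ p q → adjE expr′ p q ≡ Adj (lookup (z ∷ l) p) (lookup (z ∷ l) q)
    expr′-adj zero zero
      rewrite adjE-expr′ zero zero | adjE-addFresh-newˡ expr zero | joined-new | labels-addFresh-new expr =
      sym (Adj-irrefl z)
    expr′-adj zero (suc q)
      rewrite adjE-expr′ zero (suc q) | adjE-addFresh-newˡ expr (suc q) | old-not-fresh q | joined-old q
            | labels-addFresh-new expr = ∨-identityʳ _
    expr′-adj (suc p) zero
      rewrite adjE-expr′ (suc p) zero | adjE-addFresh-newʳ expr (suc p) | old-not-fresh p | joined-old p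
            | labels-addFresh-new expr = Adj-sym z (vertex p)
    expr′-adj (suc p) (suc q)
      rewrite adjE-expr′ (suc p) (suc q) | adjE-addFresh-old expr p q | old-not-fresh p | old-not-fresh q =
      trans (∨-identityʳ _) (expr-adj p q)

    stage : Stage (z ∷ l)
    stage = record
      { slotOf = slotOf′ ; expr = expr′ ; distinct = distinct′ ; expr-adj = expr′-adj
      ; expr-labels = expr′-labels ; slots-distinct = slots-distinct′ }

  extend : ∀ {l} (st : Stage l) (z : Fin k) → placed l z ≡ false → (s : Fin slots) →
    (∀ y → active (z ∷ l) y ≡ true → y ≢ z → Stage.slotOf st y ≢ s) → Stage (z ∷ l)
  extend = Extend.stage

module SubcubicConstruction {k} (Adj : Fin k → Fin k → Bool)
    (Adj-sym : ∀ x y → Adj x y ≡ Adj y x) (Adj-irrefl : ∀ x → Adj x x ≡ false) (m : ℕ)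
    (degree≤3 : ∀ x → count (Adj x) ≤ 3)
    (branches≤m : count (λ x → count (Adj x) ≡ᵇ 3) ≤ m) where

  slots : ℕ
  slots = suc (m + 2)

  open LinearConstruction Adj Adj-sym Adj-irrefl slots

  branch : Fin k → Bool
  branch x = count (Adj x) ≡ᵇ 3

  -- The open ends of the paths of non-branch vertices traced so far.
  openEnds : List (Fin k) → Fin k → ℕ
  openEnds l x = if placed l x ∧ not (branch x) then pending l x else 0

  potential : List (Fin k) → ℕ
  potential l = sum (openEnds l)

  placedPathNeighbours : List (Fin k) → Fin k → ℕ
  placedPathNeighbours l z = count (λ x → placed l x ∧ not (branch x) ∧ Adj x z)

  potential-place : ∀ l z → placed l z ≡ false →
    potential (z ∷ l) + placedPathNeighbours l z ≡ potential l + (if not (branch z) then pending (z ∷ l) z else 0)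
  potential-place l z z∉l =
    trans (sym (∑-distrib-+ (openEnds (z ∷ l)) closed))
     (trans (sum-cong-≗ pointwise)
      (trans (∑-distrib-+ (openEnds l) atZ) (cong (potential l +_) (sum-delta z _))))
    where
    closed atZ : Fin k → ℕ
    closed x = indicator (placed l x ∧ not (branch x) ∧ Adj x z)
    atZ x = if does (x ≟ z) then (if not (branch z) then pending (z ∷ l) z else 0) else 0
    pointwise : ∀ x → openEnds (z ∷ l) x + closed x ≡ openEnds l x + atZ x
    pointwise x with x ≟ z
    ... | yes refl rewrite z∉l = +-identityʳ _
    ... | no _ with placed l x
    ...   | false = refl
    ...   | true with not (branch x)
    ...     | false = refl
    ...     | true rewrite pending-place l z x z∉l = sym (+-identityʳ _)

  nonbranch-degree≤2 : ∀ z → not (branch z) ≡ true → count (Adj z) ≤ 2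
  nonbranch-degree≤2 z nb with count (Adj z) | degree≤3 z
  ... | 0 | _ = z≤n
  ... | 1 | _ = s≤s z≤n
  ... | 2 | _ = s≤s (s≤s z≤n)
  nonbranch-degree≤2 z () | 3 | _
  ... | suc (suc (suc (suc _))) | s≤s (s≤s (s≤s ()))

  pending+placedPathNeighbours≤2 : ∀ l z → not (branch z) ≡ true →
    pending (z ∷ l) z + placedPathNeighbours l z ≤ 2
  pending+placedPathNeighbours≤2 l z nb =
    ≤-trans (subst (_≤ count (Adj z)) (∑-distrib-+ after before) (sum-mono-≤ pointwise)) (nonbranch-degree≤2 z nb)
    where
    after before : Fin k → ℕ
    after w = indicator (Adj z w ∧ not (placed (z ∷ l) w))
    before w = indicator (placed l w ∧ not (branch w) ∧ Adj w z)
    pointwise : ∀ w → after w + before w ≤ indicator (Adj z w)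
    pointwise w rewrite Adj-sym w z with placed l w | Adj z w
    ... | true | true rewrite ∨-zeroʳ (does (w ≟ z)) with not (branch w)
    ...   | true = ≤-refl
    ...   | false = z≤n
    pointwise w | true | false with not (branch w)
    ...   | true = ≤-refl
    ...   | false = ≤-refl
    pointwise w | false | true with does (w ≟ z)
    ...   | true = z≤n
    ...   | false = ≤-refl
    pointwise w | false | false with does (w ≟ z)
    ...   | true = ≤-refl
    ...   | false = ≤-refl

  potential-place-frontier : ∀ l z → placed l z ≡ false → 1 ≤ placedPathNeighbours l z →
    potential (z ∷ l) ≤ potential l
  potential-place-frontier l z z∉l near with not (branch z) in nb | potential-place l z z∉l
  ... | false | eq = subst (potential (z ∷ l) ≤_) (trans eq (+-identityʳ _)) (m≤m+n _ _)
  ... | true | eq = +-cancelʳ-≤ 2 (potential (z ∷ l)) (potential l) (begin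
      potential (z ∷ l) + 2
    ≤⟨ +-monoʳ-≤ (potential (z ∷ l)) (+-mono-≤ near near) ⟩
      potential (z ∷ l) + (b + b)
    ≡⟨ sym (+-assoc (potential (z ∷ l)) b b) ⟩
      (potential (z ∷ l) + b) + b
    ≡⟨ cong (_+ b) eq ⟩
      (potential l + pending (z ∷ l) z) + b
    ≡⟨ +-assoc (potential l) _ b ⟩
      potential l + (pending (z ∷ l) z + b)
    ≤⟨ +-monoʳ-≤ (potential l) (pending+placedPathNeighbours≤2 l z nb) ⟩
      potential l + 2
    ∎)
    where
    open ≤-Reasoning
    b = placedPathNeighbours l z

  potential-place-anywhere : ∀ l z → placed l z ≡ false → potential l ≡ 0 → potential (z ∷ l) ≤ 2
  potential-place-anywhere l z z∉l zero-potential
    with not (branch z) in nb | potential-place l z z∉l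
  ... | false | eq = ≤-trans (m≤m+n _ _)
          (≤-trans (≤-reflexive (trans eq (trans (+-identityʳ _) zero-potential))) z≤n)
  ... | true | eq = ≤-trans (m≤m+n _ _)
          (subst (_≤ 2) (sym (trans eq (cong (_+ pending (z ∷ l) z) zero-potential)))
            (≤-trans (m≤m+n _ _) (pending+placedPathNeighbours≤2 l z nb)))

  frontier : List (Fin k) → Fin k → Bool
  frontier l w = not (placed l w) ∧ positive (placedPathNeighbours l w)

  no-frontier⇒potential≡0 : ∀ l → anyᵇ (frontier l) ≡ false → potential l ≡ 0
  no-frontier⇒potential≡0 l none = sum-zero closed
    where
    closed : ∀ x → openEnds l x ≡ 0
    closed x with placed l x ∧ not (branch x) in path
    ... | false = refl
    ... | true = sum-zero edge-placed
      where
      edge-placed : ∀ w → indicator (Adj x w ∧ not (placed l w)) ≡ 0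
      edge-placed w with Adj x w in xw | placed l w in w∈l
      ... | false | _ = refl
      ... | true | true = refl
      ... | true | false = ⊥-elim (true≢false (trans (sym (anyᵇ-intro _ w w-frontier)) none))
        where
        w-frontier : frontier l w ≡ true
        w-frontier rewrite w∈l = positive⁺ (≤-trans (≤-reflexive (sym counted)) (term≤sum _ x))
          where
          counted : indicator (placed l x ∧ not (branch x) ∧ Adj x w) ≡ 1
          counted rewrite sym (∧-assoc (placed l x) (not (branch x)) (Adj x w)) | path | xw = refl

  active-count : ∀ l → potential l ≤ 2 → count (active l) ≤ m + 2
  active-count l small =
    ≤-trans (subst (count (active l) ≤_) (∑-distrib-+ (indicator ∘ branch) (openEnds l)) (sum-mono-≤ pointwise))
            (+-mono-≤ branches≤m small)
    where
    pointwise : ∀ x → indicator (active l x) ≤ indicator (branch x) + openEnds l x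
    pointwise x with placed l x | branch x | pending l x
    ... | false | _ | _ = z≤n
    ... | true | true | zero = z≤n
    ... | true | true | suc _ = s≤s z≤n
    ... | true | false | zero = z≤n
    ... | true | false | suc _ = s≤s z≤n

  occupies : List (Fin k) → (Fin k → Fin slots) → Fin slots → Fin k → Bool
  occupies l slotOf s y = active l y ∧ does (slotOf y ≟ s)

  used : List (Fin k) → (Fin k → Fin slots) → Fin slots → Bool
  used l slotOf s = anyᵇ (occupies l slotOf s)

  free-slot : ∀ l (slotOf : Fin k → Fin slots) → count (active l) ≤ m + 2 →
    Σ (Fin slots) λ s → ∀ y → active l y ≡ true → slotOf y ≢ s
  free-slot l slotOf few with anyᵇ (not ∘ used l slotOf) in some-free
  ... | true with anyᵇ-witness (not ∘ used l slotOf) some-free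
  ...   | s , s-free = s , λ y ay eq →
            true≢false (trans (sym (anyᵇ-intro (occupies l slotOf s) y (occupied y ay eq))) (not-true⁻ s-free))
    where
    occupied : ∀ y → active l y ≡ true → slotOf y ≡ s → occupies l slotOf s y ≡ true
    occupied y ay eq rewrite ay = dec-true (slotOf y ≟ s) eq
  free-slot l slotOf few | false = ⊥-elim (<-irrefl refl (begin-strict
      m + 2
    <⟨ n<1+n _ ⟩
      slots
    ≡⟨ sym (count-true slots) ⟩
      count {slots} (λ _ → true)
    ≤⟨ count-mono-injection (λ _ → true) (active l) occupant occupant-injective (λ s _ → occupant-active s) ⟩
      count (active l)
    ≤⟨ few ⟩
      m + 2
    ∎))
    where
    open ≤-Reasoning
    all-used : ∀ s → used l slotOf s ≡ true
    all-used s with used l slotOf s in u | anyᵇ-false (not ∘ used l slotOf) some-free s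
    ... | true | _ = refl
    ... | false | ()
    occupant : Fin slots → Fin k
    occupant s = proj₁ (anyᵇ-witness (occupies l slotOf s) (all-used s))
    occupant-occupies : ∀ s → occupies l slotOf s (occupant s) ≡ true
    occupant-occupies s = proj₂ (anyᵇ-witness (occupies l slotOf s) (all-used s))
    occupant-active : ∀ s → active l (occupant s) ≡ true
    occupant-active s = proj₁ (∧-true⁻ {active l (occupant s)} (occupant-occupies s))
    occupant-slot : ∀ s → slotOf (occupant s) ≡ s
    occupant-slot s with slotOf (occupant s) ≟ s | proj₂ (∧-true⁻ {active l (occupant s)} (occupant-occupies s))
    ... | yes eq | _ = eq
    ... | no _ | ()
    occupant-injective : ∀ u v → true ≡ true → true ≡ true → occupant u ≡ occupant v → u ≡ v
    occupant-injective u v _ _ eq = trans (sym (occupant-slot u)) (trans (cong slotOf eq) (occupant-slot v))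

  unplaced : List (Fin k) → ℕ
  unplaced l = count (not ∘ placed l)

  unplaced-place : ∀ l z → placed l z ≡ false → unplaced l ≡ unplaced (z ∷ l) + 1
  unplaced-place l z z∉l =
    trans (sum-cong-≗ pointwise) (trans (∑-distrib-+ after atZ) (cong (unplaced (z ∷ l) +_) (sum-delta z 1)))
    where
    after atZ : Fin k → ℕ
    after w = indicator (not (placed (z ∷ l) w))
    atZ w = if does (w ≟ z) then 1 else 0
    pointwise : ∀ w → indicator (not (placed l w)) ≡ after w + atZ w
    pointwise w with w ≟ z
    ... | yes refl rewrite z∉l = refl
    ... | no _ = sym (+-identityʳ _)

  Complete : Set
  Complete = Σ (List (Fin k)) λ l → Stage l × (∀ x → placed l x ≡ true)

  -- Place a frontier vertex when there is one (the potential does not grow), and any unplaced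
  -- vertex otherwise (the potential was 0).
  build : ∀ fuel l → Stage l → potential l ≤ 2 → unplaced l ≤ fuel → Complete
  place : ∀ fuel l → Stage l → unplaced l ≤ fuel → ∀ z → placed l z ≡ false → potential (z ∷ l) ≤ 2 →
    Complete

  build fuel l st small bound with anyᵇ (not ∘ placed l) in some-unplaced
  ... | false = l , st , λ x → not-false⁻ (anyᵇ-false (not ∘ placed l) some-unplaced x)
  ... | true with anyᵇ (frontier l) in some-frontier
  ...   | true with anyᵇ-witness (frontier l) some-frontier
  ...     | z , z-frontier with ∧-true⁻ {not (placed l z)} z-frontier
  ...       | z∉l , near = place fuel l st bound z (not-true⁻ z∉l)
                (≤-trans (potential-place-frontier l z (not-true⁻ z∉l) (positive⁻ near)) small)
  build fuel l st small bound | true | false with anyᵇ-witness (not ∘ placed l) some-unplaced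
  ... | z , z∉l = place fuel l st bound z (not-true⁻ z∉l)
        (potential-place-anywhere l z (not-true⁻ z∉l) (no-frontier⇒potential≡0 l some-frontier))

  place zero l st bound z z∉l small with ≤-trans (term≤sum (indicator ∘ not ∘ placed l) z) bound
  ... | one≤0 rewrite z∉l with one≤0
  ...   | ()
  place (suc fuel) l st bound z z∉l small =
    build fuel (z ∷ l) (extend st z z∉l s (λ y ay _ → s-free y ay)) small
      (≤-pred (subst (_≤ suc fuel) (trans (unplaced-place l z z∉l) (+-comm _ 1)) bound))
    where
    free = free-slot (z ∷ l) (Stage.slotOf st) (active-count (z ∷ l) small)
    s = proj₁ free
    s-free = proj₂ free

  complete : Complete
  complete = build k [] (initial zero) (≤-trans (≤-reflexive (sum-zero {k} (λ _ → refl))) z≤n)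
    (≤-reflexive (count-true k))

  complete-cliqueWidth≤ : CliqueWidth≤ (2 + slots) (record { size = k ; adj = Adj })
  complete-cliqueWidth≤ =
    cliqueWidth≤-from-enumeration Adj (Stage.expr st) (lookup l) index lookup-index index-lookup (Stage.expr-adj st)
    where
    l = proj₁ complete
    st = proj₁ (proj₂ complete)
    all-placed = proj₂ (proj₂ complete)
    index : Fin k → Fin (length l)
    index x = proj₁ (placed-lookup⁻ l x (all-placed x))
    lookup-index : ∀ x → lookup l (index x) ≡ x
    lookup-index x = proj₂ (placed-lookup⁻ l x (all-placed x))
    index-lookup : ∀ p → index (lookup l p) ≡ p
    index-lookup p = Stage.distinct st _ _ (lookup-index (lookup l p))

subcubic-cliqueWidth≤ : (H : FinGraph) → (∀ x y → adj H x y ≡ adj H y x) → (∀ x → adj H x x ≡ false) →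
  (∀ x → deg H x ≤ 3) → ∀ m → branchCount H ≤ m → CliqueWidth≤ (m + 5) H
subcubic-cliqueWidth≤ H sym irrefl degree≤3 m branches≤m =
  subst (λ c → CliqueWidth≤ c H) (trans (+-comm 3 (m + 2)) (+-assoc m 2 3)) complete-cliqueWidth≤
  where
  degree≡ : ∀ x → deg H x ≡ count (adj H x)
  degree≡ x = countTrue-allFin (adj H x)
  branchCount≡ : branchCount H ≡ count (λ x → count (adj H x) ≡ᵇ 3)
  branchCount≡ = trans (countTrue-allFin (λ x → deg H x ≡ᵇ 3))
    (sum-cong-≗ λ x → cong (λ d → indicator (d ≡ᵇ 3)) (degree≡ x))
  open SubcubicConstruction (adj H) sym irrefl m
    (λ x → subst (_≤ 3) (degree≡ x) (degree≤3 x)) (subst (_≤ m) branchCount≡ branches≤m)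

-- The graphs T_n^n

-- The end of an edge of T_n at one of its endpoints: the grid direction in which the edge
-- leaves it, or the orientation of a 4-cycle edge.
data EdgeEnd : Set where
  side : Dir → EdgeEnd
  cycIn cycOut : EdgeEnd

tailEnd : ∀ {n a b} → TE n a b → EdgeEnd
tailEnd (hor _ _) = side E
tailEnd (ver _ _) = side S
tailEnd (cornerNW _ _) = side W
tailEnd (cornerNE _ _ _ _) = side E
tailEnd (cornerSW _ _ _ _) = side S
tailEnd (cornerSE _ _ _ _) = side E
tailEnd (cyc _ _ _) = cycOut

headEnd : ∀ {n a b} → TE n a b → EdgeEnd
headEnd (hor _ _) = side W
headEnd (ver _ _) = side N
headEnd (cornerNW _ _) = side N
headEnd (cornerNE _ _ _ _) = side N
headEnd (cornerSW _ _ _ _) = side W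
headEnd (cornerSE _ _ _ _) = side S
headEnd (cyc _ _ _) = cycIn

NonCorner : ℕ → ℕ → ℕ → Set
NonCorner n i j = Deg3 n i j ⊎ (Inner n i × Inner n j)

Port-nonCorner : ∀ {n i j d v} → Port n i j d v → NonCorner n i j
Port-nonCorner (p3 p) = inj₁ p
Port-nonCorner (p4 a b) = inj₂ (a , b)

inner⇒¬side : ∀ {n i} → Inner n i → Side n i → ⊥
inner⇒¬side (() , _) (inj₁ refl)
inner⇒¬side (_ , lt) (inj₂ refl) = <-irrefl refl lt

¬corner : ∀ {n i j} → NonCorner n i j → Side n i → Side n j → ⊥
¬corner (inj₁ (inj₁ (ii , _))) si sj = inner⇒¬side ii si
¬corner (inj₁ (inj₂ (_ , ij))) si sj = inner⇒¬side ij sj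
¬corner (inj₂ (ii , _)) si sj = inner⇒¬side ii si

¬Side-n : ∀ {n} → 2 < n → Side n n → ⊥
¬Side-n 2<n (inj₁ refl) with 2<n
... | ()
¬Side-n 2<n (inj₂ e) = <-irrefl (sym e) ≤-refl

¬Inner-n : ∀ {n} → Inner n n → ⊥
¬Inner-n (_ , lt) = <-irrefl refl (<-trans (n<1+n _) lt)

¬NonCorner-col-n : ∀ {n i} → 2 < n → NonCorner n i n → ⊥
¬NonCorner-col-n 2<n (inj₁ (inj₁ (_ , s))) = ¬Side-n 2<n s
¬NonCorner-col-n 2<n (inj₁ (inj₂ (_ , ii))) = ¬Inner-n ii
¬NonCorner-col-n 2<n (inj₂ (_ , ii)) = ¬Inner-n ii

¬NonCorner-row-n : ∀ {n j} → 2 < n → NonCorner n n j → ⊥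
¬NonCorner-row-n 2<n (inj₁ (inj₁ (ii , _))) = ¬Inner-n ii
¬NonCorner-row-n 2<n (inj₁ (inj₂ (s , _))) = ¬Side-n 2<n s
¬NonCorner-row-n 2<n (inj₂ (ii , _)) = ¬Inner-n ii

Deg3⇒¬Inner×Inner : ∀ {n i j} → Deg3 n i j → Inner n i → Inner n j → ⊥
Deg3⇒¬Inner×Inner (inj₁ (_ , s)) _ b = inner⇒¬side b s
Deg3⇒¬Inner×Inner (inj₂ (s , _)) a _ = inner⇒¬side a s

Inner-irrelevant : ∀ {n i} (a b : Inner n i) → a ≡ b
Inner-irrelevant (a₁ , a₂) (b₁ , b₂) = cong₂ _,_ (<-irrelevant a₁ b₁) (<-irrelevant a₂ b₂)

Side-irrelevant : ∀ {n i} → 2 < n → (a b : Side n i) → a ≡ b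
Side-irrelevant 2<n (inj₁ a) (inj₁ b) = cong inj₁ (≡-irrelevant a b)
Side-irrelevant 2<n (inj₂ a) (inj₂ b) = cong inj₂ (≡-irrelevant a b)
Side-irrelevant 2<n (inj₁ refl) (inj₂ refl) with 2<n
... | s≤s ()
Side-irrelevant 2<n (inj₂ refl) (inj₁ refl) with 2<n
... | s≤s ()

Deg3-irrelevant : ∀ {n i j} → 2 < n → (a b : Deg3 n i j) → a ≡ b
Deg3-irrelevant 2<n (inj₁ (a₁ , a₂)) (inj₁ (b₁ , b₂)) =
  cong inj₁ (cong₂ _,_ (Inner-irrelevant a₁ b₁) (Side-irrelevant 2<n a₂ b₂))
Deg3-irrelevant 2<n (inj₂ (a₁ , a₂)) (inj₂ (b₁ , b₂)) =
  cong inj₂ (cong₂ _,_ (Side-irrelevant 2<n a₁ b₁) (Inner-irrelevant a₂ b₂))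
Deg3-irrelevant 2<n (inj₁ (a₁ , _)) (inj₂ (b₁ , _)) = ⊥-elim (inner⇒¬side a₁ b₁)
Deg3-irrelevant 2<n (inj₂ (a₁ , _)) (inj₁ (b₁ , _)) = ⊥-elim (inner⇒¬side b₁ a₁)

Port-unique : ∀ {n i j d v₁ v₂} → 2 < n → (P : Port n i j d v₁) (Q : Port n i j d v₂) →
  _≡_ {A = Σ (TV n) (Port n i j d)} (v₁ , P) (v₂ , Q)
Port-unique 2<n (p3 p) (p3 q) with Deg3-irrelevant 2<n p q
... | refl = refl
Port-unique 2<n (p4 a b) (p4 a' b') with Inner-irrelevant a a' | Inner-irrelevant b b'
... | refl | refl = refl
Port-unique 2<n (p3 p) (p4 a b) = ⊥-elim (Deg3⇒¬Inner×Inner p a b)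
Port-unique 2<n (p4 a b) (p3 p) = ⊥-elim (Deg3⇒¬Inner×Inner p a b)

¬NonCorner-NW : ∀ {n} → NonCorner n 0 0 → ⊥
¬NonCorner-NW v = ¬corner v (inj₁ refl) (inj₁ refl)

¬NonCorner-NE : ∀ {n k} → suc (suc k) ≡ n → NonCorner n 0 (suc k) → ⊥
¬NonCorner-NE e v = ¬corner v (inj₁ refl) (inj₂ e)

¬NonCorner-SW : ∀ {n k} → suc (suc k) ≡ n → NonCorner n (suc k) 0 → ⊥
¬NonCorner-SW e v = ¬corner v (inj₂ e) (inj₁ refl)

¬NonCorner-SE : ∀ {n k} → suc (suc k) ≡ n → NonCorner n (suc k) (suc k) → ⊥
¬NonCorner-SE e v = ¬corner v (inj₂ e) (inj₂ e)

Out : ∀ n → TV n → Set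
Out n v = Σ (TV n) (TE n v)

tailEnd-injective : ∀ {n v b₁ b₂} → 2 < n → (t₁ : TE n v b₁) (t₂ : TE n v b₂) → tailEnd t₁ ≡ tailEnd t₂ →
     _≡_ {A = Out n v} (b₁ , t₁) (b₂ , t₂)
tailEnd-injective 2<n (hor (p3 p) Q) (hor (p3 p') Q') refl with Port-unique 2<n Q Q'
... | refl = refl
tailEnd-injective 2<n (hor (p4 a b) Q) (hor (p4 a' b') Q') refl with Port-unique 2<n Q Q'
... | refl = refl
tailEnd-injective 2<n (hor (p3 p) Q) (cornerNE k e (p3 p') Q') refl = ⊥-elim (¬NonCorner-NE e (Port-nonCorner Q))
tailEnd-injective 2<n (hor P Q) (cornerNE k e (p4 (() , _) _) Q') refl
tailEnd-injective 2<n (cornerNE k e (p3 p') Q') (hor (p3 p) Q) refl = ⊥-elim (¬NonCorner-NE e (Port-nonCorner Q))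
tailEnd-injective 2<n (cornerNE k e (p4 (() , _) _) Q') (hor P Q) refl
tailEnd-injective 2<n (hor (p3 p) Q) (cornerSE k e (p3 p') Q') refl = ⊥-elim (¬NonCorner-SE e (Port-nonCorner Q))
tailEnd-injective 2<n (hor P Q) (cornerSE k e (p4 a _) Q') refl = ⊥-elim (inner⇒¬side a (inj₂ e))
tailEnd-injective 2<n (cornerSE k e (p3 p') Q') (hor (p3 p) Q) refl = ⊥-elim (¬NonCorner-SE e (Port-nonCorner Q))
tailEnd-injective 2<n (cornerSE k e (p4 a _) Q') (hor P Q) refl = ⊥-elim (inner⇒¬side a (inj₂ e))
tailEnd-injective 2<n (cornerNE k e (p3 p) Q) (cornerNE k' e' (p3 p') Q') refl with ≡-irrelevant e e' | Port-unique 2<n Q Q'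
... | refl | refl = refl
tailEnd-injective 2<n (cornerNE k e (p4 (() , _) _) Q) (cornerNE k' e' P' Q') refl
tailEnd-injective 2<n (cornerSE k e (p3 p) Q) (cornerSE k' e' (p3 p') Q') refl with ≡-irrelevant e e' | Port-unique 2<n Q Q'
... | refl | refl = refl
tailEnd-injective 2<n (cornerSE k e (p4 a _) Q) (cornerSE k' e' P' Q') refl = ⊥-elim (inner⇒¬side a (inj₂ e))
tailEnd-injective 2<n (cornerNE k e (p3 p) Q) (cornerSE k' e' () Q') refl
tailEnd-injective 2<n (cornerSE k e (p3 p) Q) (cornerNE k' e' () Q') refl
tailEnd-injective 2<n (cornerNE k e (p4 (() , _) _) Q) (cornerSE k' e' P' Q') refl
tailEnd-injective 2<n (cornerSE k e (p4 a _) Q) (cornerNE k' e' P' Q') refl = ⊥-elim (inner⇒¬side a (inj₂ e))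
tailEnd-injective 2<n (ver (p3 p) Q) (ver (p3 p') Q') refl with Port-unique 2<n Q Q'
... | refl = refl
tailEnd-injective 2<n (ver (p4 a b) Q) (ver (p4 a' b') Q') refl with Port-unique 2<n Q Q'
... | refl = refl
tailEnd-injective 2<n (ver (p3 p) Q) (cornerSW k e (p3 p') Q') refl = ⊥-elim (¬NonCorner-SW e (Port-nonCorner Q))
tailEnd-injective 2<n (ver P Q) (cornerSW k e (p4 _ (() , _)) Q') refl
tailEnd-injective 2<n (cornerSW k e (p3 p') Q') (ver (p3 p) Q) refl = ⊥-elim (¬NonCorner-SW e (Port-nonCorner Q))
tailEnd-injective 2<n (cornerSW k e (p4 _ (() , _)) Q') (ver P Q) refl
tailEnd-injective 2<n (cornerSW k e (p3 p) Q) (cornerSW k' e' (p3 p') Q') refl with ≡-irrelevant e e' | Port-unique 2<n Q Q'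
... | refl | refl = refl
tailEnd-injective 2<n (cornerSW k e (p4 _ (() , _)) Q) (cornerSW k' e' P' Q') refl
tailEnd-injective 2<n (cornerNW (p3 p) Q) (cornerNW (p3 p') Q') refl with Port-unique 2<n Q Q'
... | refl = refl
tailEnd-injective 2<n (cornerNW (p4 (() , _) _) Q) (cornerNW P' Q') refl
tailEnd-injective 2<n (cyc a b d) (cyc a' b' d') refl = refl

In : ∀ n → TV n → Set
In n v = Σ (TV n) (λ a → TE n a v)

cycInEdge : ∀ {n} (v : TV n) → Maybe (In n v)
cycInEdge (b3 i j p) = nothing
cycInEdge (c4 i j a b N) = just (c4 i j a b W , cyc a b W)
cycInEdge (c4 i j a b E) = just (c4 i j a b N , cyc a b N)
cycInEdge (c4 i j a b S) = just (c4 i j a b E , cyc a b E)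
cycInEdge (c4 i j a b W) = just (c4 i j a b S , cyc a b S)

cycInEdge-unique : ∀ {n a v} (t : TE n a v) → headEnd t ≡ cycIn → cycInEdge v ≡ just (a , t)
cycInEdge-unique (cyc a b N) _ = refl
cycInEdge-unique (cyc a b E) _ = refl
cycInEdge-unique (cyc a b S) _ = refl
cycInEdge-unique (cyc a b W) _ = refl

headEnd-injective′ : ∀ {n v₁ v₂ a₁ a₂} → 2 < n → (t₁ : TE n a₁ v₁) (t₂ : TE n a₂ v₂) → headEnd t₁ ≡ headEnd t₂ →
     (ve : v₁ ≡ v₂) → subst (In n) ve (a₁ , t₁) ≡ (a₂ , t₂)
headEnd-injective′ 2<n t₁@(cyc a b d) t₂ eq refl =
  just-injective (trans (sym (cycInEdge-unique t₁ refl)) (cycInEdge-unique t₂ (sym eq)))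
headEnd-injective′ 2<n (hor P (p3 q)) (hor P' (p3 q')) refl refl with Port-unique 2<n P P'
... | refl = refl
headEnd-injective′ 2<n (hor P (p4 a b)) (hor P' (p4 a' b')) refl refl with Port-unique 2<n P P'
... | refl = refl
headEnd-injective′ 2<n (hor P (p3 q)) (cornerSW k e P' (p3 q')) refl refl = ⊥-elim (¬NonCorner-SW e (Port-nonCorner P))
headEnd-injective′ 2<n (hor P Q) (cornerSW k e P' (p4 a _)) refl refl = ⊥-elim (inner⇒¬side a (inj₂ e))
headEnd-injective′ 2<n (cornerSW k e P' (p3 q')) (hor P (p3 q)) refl refl = ⊥-elim (¬NonCorner-SW e (Port-nonCorner P))
headEnd-injective′ 2<n (cornerSW k e P' (p4 a _)) (hor P Q) refl refl = ⊥-elim (inner⇒¬side a (inj₂ e))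
headEnd-injective′ 2<n (cornerSW k e P (p3 q)) (cornerSW k' e' P' (p3 q')) refl refl with ≡-irrelevant e e' | Port-unique 2<n P P'
... | refl | refl = refl
headEnd-injective′ 2<n (cornerSW k e P (p4 a _)) (cornerSW k' e' P' Q') refl refl = ⊥-elim (inner⇒¬side a (inj₂ e))
headEnd-injective′ 2<n (ver P (p3 q)) (ver P' (p3 q')) refl refl with Port-unique 2<n P P'
... | refl = refl
headEnd-injective′ 2<n (ver P (p4 a b)) (ver P' (p4 a' b')) refl refl with Port-unique 2<n P P'
... | refl = refl
headEnd-injective′ 2<n (ver P (p3 q)) (cornerNW P' (p3 q')) refl refl = ⊥-elim (¬NonCorner-NW (Port-nonCorner P))
headEnd-injective′ 2<n (ver P Q) (cornerNW P' (p4 _ (() , _))) refl refl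
headEnd-injective′ 2<n (cornerNW P' (p3 q')) (ver P (p3 q)) refl refl = ⊥-elim (¬NonCorner-NW (Port-nonCorner P))
headEnd-injective′ 2<n (cornerNW P' (p4 _ (() , _))) (ver P Q) refl refl
headEnd-injective′ 2<n (ver P (p3 q)) (cornerNE k e P' (p3 q')) refl refl = ⊥-elim (¬NonCorner-NE e (Port-nonCorner P))
headEnd-injective′ 2<n (ver P Q) (cornerNE k e P' (p4 _ b)) refl refl = ⊥-elim (inner⇒¬side b (inj₂ e))
headEnd-injective′ 2<n (cornerNE k e P' (p3 q')) (ver P (p3 q)) refl refl = ⊥-elim (¬NonCorner-NE e (Port-nonCorner P))
headEnd-injective′ 2<n (cornerNE k e P' (p4 _ b)) (ver P Q) refl refl = ⊥-elim (inner⇒¬side b (inj₂ e))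
headEnd-injective′ 2<n (cornerNW P (p3 q)) (cornerNW P' (p3 q')) refl refl with Port-unique 2<n P P'
... | refl = refl
headEnd-injective′ 2<n (cornerNW P (p4 _ (() , _))) (cornerNW P' Q') refl refl
headEnd-injective′ 2<n (cornerNE k e P (p3 q)) (cornerNE k' e' P' (p3 q')) refl refl with ≡-irrelevant e e' | Port-unique 2<n P P'
... | refl | refl = refl
headEnd-injective′ 2<n (cornerNE k e P (p4 _ b)) (cornerNE k' e' P' Q') refl refl = ⊥-elim (inner⇒¬side b (inj₂ e))
headEnd-injective′ 2<n (cornerNW P (p3 q)) (cornerNE k' e' P' ()) refl refl
headEnd-injective′ 2<n (cornerNE k e P (p3 q)) (cornerNW P' ()) refl refl
headEnd-injective′ 2<n (cornerNW P (p4 _ (() , _))) (cornerNE k' e' P' Q') refl refl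
headEnd-injective′ 2<n (cornerNE k e P (p4 _ b)) (cornerNW P' Q') refl refl = ⊥-elim (inner⇒¬side b (inj₂ e))
headEnd-injective′ 2<n (cornerSE k e P (p3 q)) (cornerSE k' e' P' (p3 q')) refl refl with ≡-irrelevant e e' | Port-unique 2<n P P'
... | refl | refl = refl
headEnd-injective′ 2<n (cornerSE k e P (p4 _ b)) (cornerSE k' e' P' Q') refl refl = ⊥-elim (inner⇒¬side b (inj₂ e))

headEnd-injective : ∀ {n v a₁ a₂} → 2 < n → (t₁ : TE n a₁ v) (t₂ : TE n a₂ v) → headEnd t₁ ≡ headEnd t₂ →
     _≡_ {A = In n v} (a₁ , t₁) (a₂ , t₂)
headEnd-injective 2<n t₁ t₂ eq = headEnd-injective′ 2<n t₁ t₂ eq refl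

tailEnd≢headEnd′ : ∀ {n v₁ v₂ a b} → (t₁ : TE n v₁ b) (t₂ : TE n a v₂) → tailEnd t₁ ≡ headEnd t₂ → v₁ ≡ v₂ → ⊥
tailEnd≢headEnd′ (cornerNW (p3 p) Q) (hor P (p3 q)) refl refl = ¬NonCorner-NW (Port-nonCorner P)
tailEnd≢headEnd′ (cornerNW (p4 (() , _) _) Q) t₂ eq ve
tailEnd≢headEnd′ (cornerNW (p3 p) Q) (cornerSW k e P (p3 q)) refl ()
tailEnd≢headEnd′ (cornerNW (p3 p) Q) (cornerSW k e P (p4 _ _)) refl ()
tailEnd≢headEnd′ (cornerNW (p3 p) Q) (hor P (p4 _ _)) refl ()
tailEnd≢headEnd′ (ver (p3 p) Q) (cornerSE k e P (p3 q)) refl refl = ¬NonCorner-SE e (Port-nonCorner Q)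
tailEnd≢headEnd′ (ver (p4 a b) Q) (cornerSE k e P (p4 _ b')) refl refl = inner⇒¬side b' (inj₂ e)
tailEnd≢headEnd′ (ver (p3 p) Q) (cornerSE k e P (p4 _ _)) refl ()
tailEnd≢headEnd′ (ver (p4 _ _) Q) (cornerSE k e P (p3 _)) refl ()
tailEnd≢headEnd′ (cornerSW k e (p3 p) Q) (cornerSE k' e' P (p3 q)) refl ()
tailEnd≢headEnd′ (cornerSW k e (p4 _ (() , _)) Q) t₂ eq ve
tailEnd≢headEnd′ (cornerSW k e (p3 p) Q) (cornerSE k' e' P (p4 _ _)) refl ()

tailEnd≢headEnd : ∀ {n v a b} → (t₁ : TE n v b) (t₂ : TE n a v) → tailEnd t₁ ≡ headEnd t₂ → ⊥
tailEnd≢headEnd t₁ t₂ eq = tailEnd≢headEnd′ t₁ t₂ eq refl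

missingSide : ∀ {n i j} → Deg3 n i j → Dir
missingSide (inj₁ (_ , inj₁ _)) = W
missingSide (inj₁ (_ , inj₂ _)) = E
missingSide (inj₂ (inj₁ _ , _)) = N
missingSide (inj₂ (inj₂ _ , _)) = S

otherSides : Dir → List EdgeEnd
otherSides N = side E ∷ side S ∷ side W ∷ []
otherSides E = side N ∷ side S ∷ side W ∷ []
otherSides S = side N ∷ side E ∷ side W ∷ []
otherSides W = side N ∷ side E ∷ side S ∷ []

∈-otherSides : ∀ d m → ¬ d ≡ m → side d ∈ otherSides m
∈-otherSides N N d≢m = ⊥-elim (d≢m refl)
∈-otherSides N E _ = here refl
∈-otherSides N S _ = here refl
∈-otherSides N W _ = here refl
∈-otherSides E N _ = here refl
∈-otherSides E E d≢m = ⊥-elim (d≢m refl)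
∈-otherSides E S _ = there (here refl)
∈-otherSides E W _ = there (here refl)
∈-otherSides S N _ = there (here refl)
∈-otherSides S E _ = there (here refl)
∈-otherSides S S d≢m = ⊥-elim (d≢m refl)
∈-otherSides S W _ = there (there (here refl))
∈-otherSides W N _ = there (there (here refl))
∈-otherSides W E _ = there (there (here refl))
∈-otherSides W S _ = there (there (here refl))
∈-otherSides W W d≢m = ⊥-elim (d≢m refl)

ends : ∀ {n} → TV n → List EdgeEnd
ends (b3 i j p) = otherSides (missingSide p)
ends (c4 i j a b d) = side d ∷ cycOut ∷ cycIn ∷ []

tailEnd∈ends : ∀ {n v b} → 2 < n → (t : TE n v b) → tailEnd t ∈ ends v
tailEnd∈ends 2<n (hor (p4 a b) Q) = here refl
tailEnd∈ends 2<n (hor (p3 p) Q) = ∈-otherSides E (missingSide p) (d≢missing p)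
  where d≢missing : ∀ p → E ≢ missingSide p
        d≢missing (inj₁ (_ , inj₁ _)) ()
        d≢missing (inj₁ (_ , inj₂ e)) refl = ¬NonCorner-col-n 2<n (subst (NonCorner _ _) e (Port-nonCorner Q))
        d≢missing (inj₂ (inj₁ _ , _)) ()
        d≢missing (inj₂ (inj₂ _ , _)) ()
tailEnd∈ends 2<n (ver (p4 a b) Q) = here refl
tailEnd∈ends {n} 2<n (ver {j = j} (p3 p) Q) = ∈-otherSides S (missingSide p) (d≢missing p)
  where d≢missing : ∀ p → S ≢ missingSide p
        d≢missing (inj₁ (_ , inj₁ _)) ()
        d≢missing (inj₁ (_ , inj₂ _)) ()
        d≢missing (inj₂ (inj₁ _ , _)) ()
        d≢missing (inj₂ (inj₂ e , _)) refl = ¬NonCorner-row-n 2<n (subst (λ r → NonCorner n r j) e (Port-nonCorner Q))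
tailEnd∈ends 2<n (cornerNW (p4 (() , _) _) Q)
tailEnd∈ends 2<n (cornerNW (p3 p) Q) = ∈-otherSides W (missingSide p) (d≢missing p)
  where d≢missing : ∀ p → W ≢ missingSide p
        d≢missing (inj₁ ((() , _) , _))
        d≢missing (inj₂ (inj₁ _ , _)) ()
        d≢missing (inj₂ (inj₂ _ , _)) ()
tailEnd∈ends 2<n (cornerNE k e (p4 (() , _) _) Q)
tailEnd∈ends 2<n (cornerNE k e (p3 p) Q) = ∈-otherSides E (missingSide p) (d≢missing p)
  where d≢missing : ∀ p → E ≢ missingSide p
        d≢missing (inj₁ ((() , _) , _))
        d≢missing (inj₂ (inj₁ _ , _)) ()
        d≢missing (inj₂ (inj₂ _ , _)) ()
tailEnd∈ends 2<n (cornerSE k e (p4 a _) Q) = ⊥-elim (inner⇒¬side a (inj₂ e))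
tailEnd∈ends 2<n (cornerSE k e (p3 p) Q) = ∈-otherSides E (missingSide p) (d≢missing p)
  where d≢missing : ∀ p → E ≢ missingSide p
        d≢missing (inj₁ (a , _)) _ = inner⇒¬side a (inj₂ e)
        d≢missing (inj₂ (inj₁ _ , _)) ()
        d≢missing (inj₂ (inj₂ _ , _)) ()
tailEnd∈ends 2<n (cornerSW k e (p4 _ (() , _)) Q)
tailEnd∈ends 2<n (cornerSW k e (p3 p) Q) = ∈-otherSides S (missingSide p) (d≢missing p)
  where d≢missing : ∀ p → S ≢ missingSide p
        d≢missing (inj₁ (_ , inj₁ _)) ()
        d≢missing (inj₁ (_ , inj₂ _)) ()
        d≢missing (inj₂ (_ , (() , _)))
tailEnd∈ends 2<n (cyc a b d) = there (here refl)

headEnd∈ends : ∀ {n a v} → 2 < n → (t : TE n a v) → headEnd t ∈ ends v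
headEnd∈ends 2<n (hor P (p4 a b)) = here refl
headEnd∈ends 2<n (hor P (p3 p)) = ∈-otherSides W (missingSide p) (d≢missing p)
  where d≢missing : ∀ p → W ≢ missingSide p
        d≢missing (inj₁ (_ , inj₁ ())) refl
        d≢missing (inj₁ (_ , inj₂ _)) ()
        d≢missing (inj₂ (inj₁ _ , _)) ()
        d≢missing (inj₂ (inj₂ _ , _)) ()
headEnd∈ends 2<n (ver P (p4 a b)) = here refl
headEnd∈ends 2<n (ver P (p3 p)) = ∈-otherSides N (missingSide p) (d≢missing p)
  where d≢missing : ∀ p → N ≢ missingSide p
        d≢missing (inj₁ (_ , inj₁ _)) ()
        d≢missing (inj₁ (_ , inj₂ _)) ()
        d≢missing (inj₂ (inj₁ () , _)) refl
        d≢missing (inj₂ (inj₂ _ , _)) ()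
headEnd∈ends 2<n (cornerNW P (p4 _ (() , _)))
headEnd∈ends 2<n (cornerNW P (p3 p)) = ∈-otherSides N (missingSide p) (d≢missing p)
  where d≢missing : ∀ p → N ≢ missingSide p
        d≢missing (inj₁ (_ , inj₁ _)) ()
        d≢missing (inj₁ (_ , inj₂ _)) ()
        d≢missing (inj₂ (_ , (() , _)))
headEnd∈ends 2<n (cornerNE k e P (p4 _ b)) = ⊥-elim (inner⇒¬side b (inj₂ e))
headEnd∈ends 2<n (cornerNE k e P (p3 p)) = ∈-otherSides N (missingSide p) (d≢missing p)
  where d≢missing : ∀ p → N ≢ missingSide p
        d≢missing (inj₁ (_ , inj₁ _)) ()
        d≢missing (inj₁ (_ , inj₂ _)) ()
        d≢missing (inj₂ (_ , b)) _ = inner⇒¬side b (inj₂ e)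
headEnd∈ends 2<n (cornerSW k e P (p4 a _)) = ⊥-elim (inner⇒¬side a (inj₂ e))
headEnd∈ends 2<n (cornerSW k e P (p3 p)) = ∈-otherSides W (missingSide p) (d≢missing p)
  where d≢missing : ∀ p → W ≢ missingSide p
        d≢missing (inj₁ (a , _)) _ = inner⇒¬side a (inj₂ e)
        d≢missing (inj₂ (inj₁ _ , _)) ()
        d≢missing (inj₂ (inj₂ _ , _)) ()
headEnd∈ends 2<n (cornerSE k e P (p4 _ b)) = ⊥-elim (inner⇒¬side b (inj₂ e))
headEnd∈ends 2<n (cornerSE k e P (p3 p)) = ∈-otherSides S (missingSide p) (d≢missing p)
  where d≢missing : ∀ p → S ≢ missingSide p
        d≢missing (inj₁ (_ , inj₁ _)) ()
        d≢missing (inj₁ (_ , inj₂ _)) ()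
        d≢missing (inj₂ (_ , b)) _ = inner⇒¬side b (inj₂ e)
headEnd∈ends 2<n (cyc a b d) = there (there (here refl))



-- A neighbour of a subdivision vertex lies backward or forward along its path; a neighbour of
-- an original vertex is located by the end at which its path leaves that vertex.
data NeighbourCode : Set where
  backward forward : NeighbourCode
  along : EdgeEnd → NeighbourCode

neighbourCode : ∀ {n x y} → TnnAdj n x y → NeighbourCode
neighbourCode (inj₁ (direct _ _)) = backward
neighbourCode (inj₁ (first ((a , b) , te) k _)) = along (tailEnd te)
neighbourCode (inj₁ (inner _ _ _ _)) = forward
neighbourCode (inj₁ (last _ _ _)) = forward
neighbourCode (inj₂ (direct _ _)) = backward
neighbourCode (inj₂ (first _ _ _)) = backward
neighbourCode (inj₂ (inner _ _ _ _)) = backward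
neighbourCode (inj₂ (last ((a , b) , te) k _)) = along (headEnd te)

n≢1 : ∀ {n} → 2 < n → ¬ n ≡ 1
n≢1 (s≤s (s≤s _)) ()

codes : ∀ {n} → TnnV n → List NeighbourCode
codes (orig v) = map along (ends v)
codes (mid e k) = backward ∷ forward ∷ []

length-codes≤3 : ∀ {n} (x : TnnV n) → length (codes x) ≤ 3
length-codes≤3 (orig (b3 i j p)) with missingSide p
... | N = ≤-refl
... | E = ≤-refl
... | S = ≤-refl
... | W = ≤-refl
length-codes≤3 (orig (c4 i j a b d)) = ≤-refl
length-codes≤3 (mid e k) = s≤s (s≤s z≤n)

neighbourCode∈codes : ∀ {n x y} → 2 < n → (a : TnnAdj n x y) → neighbourCode a ∈ codes x
neighbourCode∈codes 2<n (inj₁ (direct _ e)) = ⊥-elim (n≢1 2<n e)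
neighbourCode∈codes 2<n (inj₁ (first ((a , b) , te) k _)) = ∈-map⁺ along (tailEnd∈ends 2<n te)
neighbourCode∈codes 2<n (inj₁ (inner _ _ _ _)) = there (here refl)
neighbourCode∈codes 2<n (inj₁ (last _ _ _)) = there (here refl)
neighbourCode∈codes 2<n (inj₂ (direct _ e)) = ⊥-elim (n≢1 2<n e)
neighbourCode∈codes 2<n (inj₂ (first _ _ _)) = here refl
neighbourCode∈codes 2<n (inj₂ (inner _ _ _ _)) = here refl
neighbourCode∈codes 2<n (inj₂ (last ((a , b) , te) k _)) = ∈-map⁺ along (headEnd∈ends 2<n te)

along-injective : ∀ {x y} → along x ≡ along y → x ≡ y
along-injective refl = refl

neighbourCode-injective : ∀ {n x y₁ y₂} → 2 < n → (a₁ : TnnAdj n x y₁) (a₂ : TnnAdj n x y₂) →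
  neighbourCode a₁ ≡ neighbourCode a₂ → y₁ ≡ y₂
neighbourCode-injective 2<n (inj₁ (direct _ e)) a₂ c = ⊥-elim (n≢1 2<n e)
neighbourCode-injective 2<n (inj₂ (direct _ e)) a₂ c = ⊥-elim (n≢1 2<n e)
neighbourCode-injective 2<n a₁ (inj₁ (direct _ e)) c = ⊥-elim (n≢1 2<n e)
neighbourCode-injective 2<n a₁ (inj₂ (direct _ e)) c = ⊥-elim (n≢1 2<n e)
neighbourCode-injective 2<n (inj₁ (first ((a , b) , te) k z)) (inj₁ (first ((.a , b') , te') k' z')) c
  with tailEnd-injective 2<n te te' (along-injective c)
... | refl = cong (mid ((a , b) , te)) (FinP.toℕ-injective (trans z (sym z')))
neighbourCode-injective 2<n (inj₁ (first ((a , b) , te) k z)) (inj₂ (last ((a' , .a) , te') k' z')) c =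
  ⊥-elim (tailEnd≢headEnd te te' (along-injective c))
neighbourCode-injective 2<n (inj₂ (last ((a' , b) , te') k' z')) (inj₁ (first ((.b , b₂) , te) k z)) c =
  ⊥-elim (tailEnd≢headEnd te te' (along-injective (sym c)))
neighbourCode-injective 2<n (inj₂ (last ((a , b) , te) k z)) (inj₂ (last ((a' , .b) , te') k' z')) c
  with headEnd-injective 2<n te te' (along-injective c)
... | refl = cong (mid ((a , b) , te)) (FinP.toℕ-injective (suc-injective (trans z (sym z'))))
neighbourCode-injective 2<n (inj₁ (inner e k k1 z)) (inj₁ (inner .e .k k2 z')) c =
  cong (mid e) (FinP.toℕ-injective (trans z (sym z')))
neighbourCode-injective {n} 2<n (inj₁ (inner e k k1 z)) (inj₁ (last .e .k z')) c =
  ⊥-elim (<-irrefl refl (subst (_< n ∸ 1) (trans z z') (FinP.toℕ<n k1)))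
neighbourCode-injective {n} 2<n (inj₁ (last e k z')) (inj₁ (inner .e .k k1 z)) c =
  ⊥-elim (<-irrefl refl (subst (_< n ∸ 1) (trans z z') (FinP.toℕ<n k1)))
neighbourCode-injective 2<n (inj₁ (last e k z)) (inj₁ (last .e .k z')) c = refl
neighbourCode-injective 2<n (inj₂ (first e k z)) (inj₂ (first .e .k z')) c = refl
neighbourCode-injective 2<n (inj₂ (first e k z)) (inj₂ (inner .e k0 .k z')) c with trans (sym z) z'
... | ()
neighbourCode-injective 2<n (inj₂ (inner e k0 k z')) (inj₂ (first .e .k z)) c with trans (sym z) z'
... | ()
neighbourCode-injective 2<n (inj₂ (inner e k0 k z)) (inj₂ (inner .e k0' .k z')) c =
  cong (mid e) (FinP.toℕ-injective (suc-injective (trans (sym z) z')))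

SE-irreflexive : ∀ {n x y} → 2 < n → SE (TPres n) n x y → x ≡ y → ⊥
SE-irreflexive 2<n (direct _ e) _ = n≢1 2<n e
SE-irreflexive 2<n (first _ _ _) ()
SE-irreflexive 2<n (inner e k k' z) refl = <-irrefl refl (subst (toℕ k <_) (sym z) ≤-refl)
SE-irreflexive 2<n (last _ _ _) ()

Γ-symmetric : ∀ {H} → InΓ H → ∀ x y → adj H x y ≡ adj H y x
Γ-symmetric {H} (n , 2<n , f , f-injective , f-embeds) x y with adj H x y in xy | adj H y x in yx
... | true | true = refl
... | false | false = refl
... | true | false = trans (sym (proj₂ (f-embeds y x) (swap (proj₁ (f-embeds x y) xy)))) yx
... | false | true = sym (trans (sym (proj₂ (f-embeds x y) (swap (proj₁ (f-embeds y x) yx)))) xy)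

Γ-irreflexive : ∀ {H} → InΓ H → ∀ x → adj H x x ≡ false
Γ-irreflexive {H} (n , 2<n , f , f-injective , f-embeds) x with adj H x x in xx
... | false = refl
... | true with proj₁ (f-embeds x x) xx
...   | inj₁ loop = ⊥-elim (SE-irreflexive 2<n loop refl)
...   | inj₂ loop = ⊥-elim (SE-irreflexive 2<n loop refl)

Γ-degree≤3 : ∀ {H} → InΓ H → ∀ u → deg H u ≤ 3
Γ-degree≤3 {H} (n , 2<n , f , f-injective , f-embeds) u =
  subst (_≤ 3) (sym (countTrue-allFin (adj H u)))
    (≤-trans (count≤length (adj H u) code (codes (f u)) code-injective code∈codes) (length-codes≤3 (f u)))
  where
  code : ∀ w → adj H u w ≡ true → NeighbourCode
  code w uw = neighbourCode (proj₁ (f-embeds u w) uw)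
  code-injective : ∀ v w uv uw → code v uv ≡ code w uw → v ≡ w
  code-injective v w uv uw eq =
    f-injective v w (neighbourCode-injective 2<n (proj₁ (f-embeds u v) uv) (proj₁ (f-embeds u w) uw) eq)
  code∈codes : ∀ w uw → code w uw ∈ codes (f u)
  code∈codes w uw = neighbourCode∈codes 2<n (proj₁ (f-embeds u w) uw)

m+5≤3*2^[m∸1] : ∀ m → 2 < m → m + 5 ≤ 3 * 2 ^ (m ∸ 1)
m+5≤3*2^[m∸1] (suc (suc (suc j))) (s≤s (s≤s (s≤s _))) = subst (_≤ 3 * 2 ^ (2 + j)) (cong (3 +_) (+-comm 5 j)) (bound j)
  where
  open import Data.Nat.Solver using (module +-*-Solver)
  open +-*-Solver
  double : ∀ a → 3 * (2 * a) ≡ 3 * a + 3 * a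
  double = solve 1 (λ a → con 3 :* (con 2 :* a) := con 3 :* a :+ con 3 :* a) refl
  bound : ∀ j → 8 + j ≤ 3 * 2 ^ (2 + j)
  bound zero = s≤s (s≤s (s≤s (s≤s (s≤s (s≤s (s≤s (s≤s z≤n)))))))
  bound (suc j) = begin
      1 + (8 + j)                         ≤⟨ +-monoˡ-≤ (8 + j) {1} {8 + j} (s≤s z≤n) ⟩
      (8 + j) + (8 + j)                   ≤⟨ +-mono-≤ (bound j) (bound j) ⟩
      3 * 2 ^ (2 + j) + 3 * 2 ^ (2 + j)   ≡⟨ sym (double (2 ^ (2 + j))) ⟩
      3 * 2 ^ (3 + j)                     ∎
    where open ≤-Reasoning

lemma4 : (H : FinGraph) → InΓ H → (m : ℕ) → 2 < m →
         branchCount H ≤ m → CliqueWidth≤ (3 * 2 ^ (m ∸ 1)) H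
lemma4 H H∈Γ m 2<m branches≤m =
  cliqueWidth≤-mono H (m+5≤3*2^[m∸1] m 2<m)
    (subcubic-cliqueWidth≤ H (Γ-symmetric H∈Γ) (Γ-irreflexive H∈Γ) (Γ-degree≤3 H∈Γ) m branches≤m)
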